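{- Let $P_0,P_1\subset\mathbb{R}^{d-1}$ be strictly isomorphic smooth lattice $(d-1)$-polytopes with common inner normal fan $\Sigma$, let $s$ be a positive integer, and let $P=\mathrm{Cay}^s_\Sigma(P_0,P_1)=\mathrm{conv}((P_0,0)\cup(P_1,s))\subset\mathbb{R}^d$ be $d$-dimensional. Then $P$ is smooth if and only if every edge of $P$ joining a vertex of $(P_0,0)$ to a vertex of $(P_1,s)$ contains exactly $s+1$ lattice points.
   Context: A lattice $d$-polytope is smooth if exactly $d$ edges pass through each vertex and the primitive edge directions at each vertex form a basis of $\mathbb{Z}^d$. Strictly isomorphic polytopes are polytopes with the same inner normal fan. $(Q,t)=\{(q,t):q\in Q\}$. -}

module Defs where

open import Level using (0ℓ)
open import Data.Nat as ℕ using (ℕ; zero; suc)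
open import Data.Fin using (Fin; zero; suc)
open import Data.Integer as ℤ using (ℤ; +_)
open import Data.Integer.Divisibility as ℤD using ()
open import Data.Rational as ℚ using (ℚ; 0ℚ; 1ℚ)
open import Data.Product using (Σ; ∃; _×_; _,_)
open import Relation.Nullary using (¬_)
open import Relation.Unary using (Pred; _∈_)
open import Relation.Binary.PropositionalEquality using (_≡_)
open import Function.Bundles using (_⇔_)

Point : ℕ → Set
Point n = Fin n → ℚ

LPoint : ℕ → Set
LPoint n = Fin n → ℤ

PSet : ℕ → Set₁
PSet n = Pred (Point n) 0ℓ

_≋_ : ∀ {n} → Point n → Point n → Set
x ≋ y = ∀ i → x i ≡ y i

_≋ℤ_ : ∀ {n} → LPoint n → LPoint n → Set
x ≋ℤ y = ∀ i → x i ≡ y i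

toℚ : ∀ {n} → LPoint n → Point n
toℚ z i = z i ℚ./ 1

sumℚ : ∀ {k} → (Fin k → ℚ) → ℚ
sumℚ {zero}  f = 0ℚ
sumℚ {suc k} f = f zero ℚ.+ sumℚ (λ i → f (suc i))

sumℤ : ∀ {k} → (Fin k → ℤ) → ℤ
sumℤ {zero}  f = + 0
sumℤ {suc k} f = f zero ℤ.+ sumℤ (λ i → f (suc i))

_·_ : ∀ {n} → Point n → Point n → ℚ
c · x = sumℚ (λ i → c i ℚ.* x i)

Conv : ∀ {n} → PSet n → PSet n
Conv {n} S x =
  Σ ℕ λ k → Σ (Fin k → Point n) λ p → Σ (Fin k → ℚ) λ λc →
    (∀ j → p j ∈ S) × (∀ j → 0ℚ ℚ.≤ λc j) × (sumℚ λc ≡ 1ℚ) ×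
    (∀ i → sumℚ (λ j → λc j ℚ.* p j i) ≡ x i)

LatticePolytope : ∀ {n k} → (Fin k → LPoint n) → PSet n
LatticePolytope V = Conv (λ x → ∃ λ j → x ≋ toℚ (V j))

Seg : ∀ {n} → Point n → Point n → PSet n
Seg u v x = Σ ℚ λ t → (0ℚ ℚ.≤ t) × (t ℚ.≤ 1ℚ) ×
  (∀ i → x i ≡ (1ℚ ℚ.- t) ℚ.* u i ℚ.+ t ℚ.* v i)

-- face of P minimising the linear functional c (inner normal c)
Face : ∀ {n} → Point n → PSet n → PSet n
Face c P x = x ∈ P × (∀ y → y ∈ P → (c · x) ℚ.≤ (c · y))

IsVertex : ∀ {n} → PSet n → Point n → Set
IsVertex P v = ∃ λ c → ∀ x → (x ∈ Face c P) ⇔ (x ≋ v)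

IsEdge : ∀ {n} → PSet n → Point n → Point n → Set
IsEdge P u v = (¬ (u ≋ v)) × ∃ λ c → ∀ x → (x ∈ Face c P) ⇔ (x ∈ Seg u v)

FullDim : ∀ {n} → PSet n → Set
FullDim P = (∃ λ x → x ∈ P) ×
  (∀ c → (∀ x y → x ∈ P → y ∈ P → c · x ≡ c · y) → ∀ i → c i ≡ 0ℚ)

IsPrimitiveDir : ∀ {n} → Point n → LPoint n → Set
IsPrimitiveDir d w =
  (∀ (m : ℕ) → (∀ i → (+ m) ℤD.∣ w i) → m ≡ 1) ×
  (Σ ℚ λ r → (0ℚ ℚ.< r) × (∀ i → d i ≡ r ℚ.* (w i ℚ./ 1)))

IsBasis : ∀ {n} → (Fin n → LPoint n) → Set
IsBasis {n} w =
  (∀ (z : LPoint n) → ∃ λ (a : Fin n → ℤ) → ∀ i → sumℤ (λ j → a j ℤ.* w j i) ≡ z i) ×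
  (∀ (a : Fin n → ℤ) → (∀ i → sumℤ (λ j → a j ℤ.* w j i) ≡ + 0) → ∀ j → a j ≡ + 0)

Smooth : ∀ {n} → PSet n → Set
Smooth {n} P = ∀ v → IsVertex P v →
  Σ (Fin n → Point n) λ u → Σ (Fin n → LPoint n) λ w →
    (∀ i j → u i ≋ u j → i ≡ j) ×
    (∀ i → IsEdge P v (u i)) ×
    (∀ y → IsEdge P v y → ∃ λ i → u i ≋ y) ×
    (∀ i → IsPrimitiveDir (λ l → u i l ℚ.- v l) (w i)) ×
    IsBasis w

NormalCone : ∀ {n} → PSet n → Point n → Pred (Point n) 0ℓ
NormalCone P c₀ c = ∀ x → x ∈ Face c₀ P → x ∈ Face c P

-- same inner normal fan (strictly isomorphic): same set of normal cones
SameNormalFan : ∀ {n} → PSet n → PSet n → Set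
SameNormalFan P Q =
  (∀ c₀ → ∃ λ c₁ → ∀ c → NormalCone P c₀ c ⇔ NormalCone Q c₁ c) ×
  (∀ c₁ → ∃ λ c₀ → ∀ c → NormalCone Q c₁ c ⇔ NormalCone P c₀ c)

-- (x,t) ∈ ℚ^(n+1), t being the last coordinate
lift : ∀ {n} → Point n → ℚ → Point (suc n)
lift {zero}  x t zero    = t
lift {suc n} x t zero    = x zero
lift {suc n} x t (suc i) = lift (λ j → x (suc j)) t i

Cayley : ∀ {n} → PSet n → PSet n → ℕ → PSet (suc n)
Cayley P₀ P₁ s = Conv (λ x →
  (∃ λ y → y ∈ P₀ × x ≋ lift y 0ℚ) ⊎′ (∃ λ y → y ∈ P₁ × x ≋ lift y ((+ s) ℚ./ 1)))
  where open import Data.Sum using () renaming (_⊎_ to _⊎′_)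

LatticeCount : ∀ {n} → Point n → Point n → ℕ → Set
LatticeCount {n} u v m = Σ (Fin m → LPoint n) λ f →
  (∀ i j → f i ≋ℤ f j → i ≡ j) ×
  (∀ i → toℚ (f i) ∈ Seg u v) ×
  (∀ (z : LPoint n) → toℚ z ∈ Seg u v → ∃ λ i → z ≋ℤ f i)

module Submission where

-- Every vertex of P is a lift (x,0) of a
-- vertex x of P₀ or a lift (y,s) of a vertex y of P₁.  At (x,0) the edges of P are the n lifts
-- of the edges of P₀ at x (tilt their normals steeply: liftedFace) and a single edge to (y,s),
-- where y is the vertex of P₁ exposed by the normals of x (upEdge, corrVertex, fan-unique).
-- Hence P is smooth at (x,0) iff the lifted basis of P₀ at x together with the primitive
-- direction of [(x,0),(y,s)] is a basis of ℤⁿ⁺¹, i.e. iff that direction has height ±1,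
-- i.e. iff y − x = s·W with W integral, i.e. iff [(x,0),(y,s)] has exactly s + 1 lattice
-- points (divisible⇒latticeCount, latticeCount⇒divisible).  The vertices at height s are
-- handled by the same argument after exchanging the roles of P₀ and P₁.

open import Defs

module SmoothCayley where

  open import Data.Nat as ℕ using (ℕ; zero; suc)
  import Data.Nat.Properties as ℕP
  import Data.Nat.Divisibility as ℕD
  import Data.Nat.Coprimality as Cop
  open import Data.Fin as F using (Fin; zero; suc)
  import Data.Fin.Properties as FP
  open import Data.Integer as ℤ using (ℤ)
  import Data.Integer.Properties as ℤP
  import Data.Integer.Divisibility as ℤD
  open import Data.Integer.Solver renaming (module +-*-Solver to ℤS)
  open import Data.Rational
  open import Data.Rational.Properties
  open import Data.Rational.Solver
  open import Data.Rational.Unnormalised as U using (mkℚᵘ; *≡*)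
  import Data.Rational.Unnormalised.Properties as UP
  open import Data.Product
  open import Data.Sum using (_⊎_; inj₁; inj₂; [_,_]′)
  open import Data.Empty
  open import Data.Unit using (tt)
  open import Relation.Binary.PropositionalEquality
  open import Relation.Binary.Definitions using (tri<; tri≈; tri>)
  open import Relation.Nullary
  open import Relation.Nullary.Decidable using (¬?; decidable-stable)
  open import Function.Bundles using (_⇔_; mk⇔; Equivalence)
  open Equivalence using (to; from)
  open +-*-Solver

  nn+nn≡0ˡ : ∀ {a b} → 0ℚ ≤ a → 0ℚ ≤ b → a + b ≡ 0ℚ → a ≡ 0ℚ
  nn+nn≡0ˡ {a} {b} 0≤a 0≤b e = ≤-antisym a≤0 0≤a
    where
    a≤0 : a ≤ 0ℚ
    a≤0 = ≤-trans (≤-reflexive (sym (+-identityʳ a)))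
            (≤-trans (+-monoʳ-≤ a 0≤b) (≤-reflexive e))

  nn+nn≡0ʳ : ∀ {a b} → 0ℚ ≤ a → 0ℚ ≤ b → a + b ≡ 0ℚ → b ≡ 0ℚ
  nn+nn≡0ʳ {a} {b} 0≤a 0≤b e = nn+nn≡0ˡ 0≤b 0≤a (trans (+-comm b a) e)

  ≤∧≢⇒< : ∀ {a b} → a ≤ b → a ≢ b → a < b
  ≤∧≢⇒< {a} {b} a≤b a≢b with <-cmp a b
  ... | tri< x _ _ = x
  ... | tri≈ _ x _ = ⊥-elim (a≢b x)
  ... | tri> _ _ x = ⊥-elim (<-irrefl refl (<-≤-trans x a≤b))

  ≤⇒0≤- : ∀ {a b} → a ≤ b → 0ℚ ≤ b - a
  ≤⇒0≤- {a} {b} a≤b = ≤-trans (≤-reflexive (sym (+-inverseʳ a))) (+-monoˡ-≤ (- a) a≤b)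

  0≤-⇒≤ : ∀ {a b} → 0ℚ ≤ b - a → a ≤ b
  0≤-⇒≤ {a} {b} h = ≤-trans (≤-reflexive (sym (+-identityˡ a)))
    (≤-trans (+-monoˡ-≤ a h) (≤-reflexive (solve 2 (λ a b → (b :- a) :+ a := b) refl a b)))

  -≡0⇒≡ : ∀ {a b} → a - b ≡ 0ℚ → a ≡ b
  -≡0⇒≡ {a} {b} e = begin
    a ≡⟨ solve 2 (λ a b → a := (a :- b) :+ b) refl a b ⟩
    (a - b) + b ≡⟨ cong (_+ b) e ⟩
    0ℚ + b ≡⟨ +-identityˡ b ⟩
    b ∎
    where open ≡-Reasoning

  nn*nn : ∀ {a b} → 0ℚ ≤ a → 0ℚ ≤ b → 0ℚ ≤ a * b
  nn*nn {a} {b} ha hb = ≤-trans (≤-reflexive (sym (*-zeroʳ a))) (*-monoˡ-≤-nonNeg a {{nonNegative ha}} hb)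

  sq-nn : ∀ a → 0ℚ ≤ a * a
  sq-nn a with ≤-total 0ℚ a
  ... | inj₁ h = nn*nn h h
  ... | inj₂ h = ≤-trans (nn*nn h' h') (≤-reflexive (solve 1 (λ a → (:- a) :* (:- a) := a :* a) refl a))
    where h' = ≤-trans (≤-reflexive (sym (neg-inverse-zero))) (neg-antimono-≤ h)
            where neg-inverse-zero : - 0ℚ ≡ 0ℚ
                  neg-inverse-zero = refl

  mul-cancel : ∀ {a b} → a ≢ 0ℚ → a * b ≡ 0ℚ → b ≡ 0ℚ
  mul-cancel {a} {b} a≢0 e = begin
    b ≡⟨ sym (*-identityˡ b) ⟩
    1ℚ * b ≡⟨ cong (_* b) (sym (*-inverseˡ a {{≢-nonZero a≢0}})) ⟩
    ((1/ a) {{≢-nonZero a≢0}} * a) * b ≡⟨ *-assoc ((1/ a) {{≢-nonZero a≢0}}) a b ⟩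
    (1/ a) {{≢-nonZero a≢0}} * (a * b) ≡⟨ cong ((1/ a) {{≢-nonZero a≢0}} *_) e ⟩
    (1/ a) {{≢-nonZero a≢0}} * 0ℚ ≡⟨ *-zeroʳ ((1/ a) {{≢-nonZero a≢0}}) ⟩
    0ℚ ∎
    where open ≡-Reasoning

  mul-nonzero : ∀ {a b} → a ≢ 0ℚ → b ≢ 0ℚ → a * b ≢ 0ℚ
  mul-nonzero a≢0 b≢0 e = b≢0 (mul-cancel a≢0 e)

  1-≢ : ∀ {a b} → a ≢ b → b - a ≢ 0ℚ
  1-≢ {a} {b} ne e = ne (sym (-≡0⇒≡ e))

  inv-mul : ∀ a b (ne : a ≢ 0ℚ) → (b * (1/ a) {{≢-nonZero ne}}) * a ≡ b
  inv-mul a b ne = trans (*-assoc b _ a) (trans (cong (b *_) (*-inverseˡ a {{≢-nonZero ne}})) (*-identityʳ b))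

  -- A total inverse on ℚ (inv 0 = 0), for quotients whose divisor may vanish.
  inv : ℚ → ℚ
  inv a with a ≟ 0ℚ
  ... | yes _ = 0ℚ
  ... | no ne = (1/ a) {{≢-nonZero ne}}

  invl : ∀ a → a ≢ 0ℚ → inv a * a ≡ 1ℚ
  invl a ne with a ≟ 0ℚ
  ... | yes e = ⊥-elim (ne e)
  ... | no ne' = *-inverseˡ a {{≢-nonZero ne'}}

  inv-nn : ∀ a → 0ℚ ≤ a → 0ℚ ≤ inv a
  inv-nn a h with a ≟ 0ℚ
  ... | yes _ = ≤-refl
  ... | no ne = nonNegative⁻¹ ((1/ a) {{≢-nonZero ne}}) {{pos⇒nonNeg ((1/ a) {{≢-nonZero ne}}) {{1/pos⇒pos a {{positive (≤∧≢⇒< h (λ e → ne (sym e)))}}}}}}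

  +-cancelʳ-≡ : ∀ {p q} r → p + r ≡ q + r → p ≡ q
  +-cancelʳ-≡ {p} {q} r e = trans (solve 2 (λ p r → p := p :+ r :- r) refl p r) (trans (cong (_- r) e) (solve 2 (λ q r → q :+ r :- r := q) refl q r))

  +-cancelʳ-≤' : ∀ {p q} r → p + r ≤ q + r → p ≤ q
  +-cancelʳ-≤' {p} {q} r le = ≤-trans (≤-reflexive (solve 2 (λ p r → p := p :+ r :- r) refl p r))
        (≤-trans (+-monoˡ-≤ (- r) le) (≤-reflexive (solve 2 (λ q r → q :+ r :- r := q) refl q r)))

  +-cancelˡ-≤' : ∀ {p q} r → r + p ≤ r + q → p ≤ q
  +-cancelˡ-≤' {p} {q} r le = +-cancelʳ-≤' r (≤-trans (≤-reflexive (+-comm p r)) (≤-trans le (≤-reflexive (+-comm r q))))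

  le-by : ∀ {X Y} A B → 0ℚ ≤ A → 0ℚ ≤ B → X - Y ≡ A + B → Y ≤ X
  le-by A B hA hB e = 0≤-⇒≤ (≤-trans (+-mono-≤ hA hB) (≤-reflexive (sym e)))

  abs-ge : ∀ a → a ≤ ∣ a ∣
  abs-ge a with ∣p∣≡p∨∣p∣≡-p a
  ... | inj₁ e = ≤-reflexive (sym e)
  ... | inj₂ e = ≤-trans a≤-a (≤-reflexive (sym e))
    where
    0≤-a : 0ℚ ≤ - a
    0≤-a = ≤-trans (nonNegative⁻¹ ∣ a ∣ {{∣-∣-nonNeg a}}) (≤-reflexive e)
    a≤-a : a ≤ - a
    a≤-a = le-by (- a) (- a) 0≤-a 0≤-a (solve 1 (λ a → (:- a) :- a := (:- a) :+ (:- a)) refl a)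

  abs-ge-neg : ∀ a → - a ≤ ∣ a ∣
  abs-ge-neg a = ≤-trans (abs-ge (- a)) (≤-reflexive (∣-p∣≡∣p∣ a))

  abs-nn : ∀ a → 0ℚ ≤ ∣ a ∣
  abs-nn a = nonNegative⁻¹ ∣ a ∣ {{∣-∣-nonNeg a}}

  neg-abs-le : ∀ a → - ∣ a ∣ ≤ a
  neg-abs-le a = ≤-trans (neg-antimono-≤ (abs-ge-neg a)) (≤-reflexive (solve 1 (λ a → :- (:- a) := a) refl a))

  0≤1 : 0ℚ ≤ 1ℚ
  0≤1 = ≤ᵇ⇒≤ tt

  0<1 : 0ℚ < 1ℚ
  0<1 = ≤∧≢⇒< 0≤1 (λ e → 1≢0 (sym e))

  <+1 : ∀ m → m < m + 1ℚ
  <+1 m = subst (_< m + 1ℚ) (+-identityʳ m) (+-monoʳ-< m 0<1)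

  sum-cong : ∀ {k} {f g : Fin k → ℚ} → (∀ i → f i ≡ g i) → sumℚ f ≡ sumℚ g
  sum-cong {zero} e = refl
  sum-cong {suc k} e = cong₂ _+_ (e zero) (sum-cong (λ i → e (suc i)))

  sum-0 : ∀ k → sumℚ {k} (λ _ → 0ℚ) ≡ 0ℚ
  sum-0 zero = refl
  sum-0 (suc k) = trans (cong (0ℚ +_) (sum-0 k)) refl

  sum-+ : ∀ {k} (f g : Fin k → ℚ) → sumℚ (λ i → f i + g i) ≡ sumℚ f + sumℚ g
  sum-+ {zero} f g = refl
  sum-+ {suc k} f g =
    trans (cong ((f zero + g zero) +_) (sum-+ (λ i → f (suc i)) (λ i → g (suc i))))
          (solve 4 (λ a b c d → (a :+ b) :+ (c :+ d) := (a :+ c) :+ (b :+ d)) refl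
             (f zero) (g zero) (sumℚ (λ i → f (suc i))) (sumℚ (λ i → g (suc i))))

  sum-* : ∀ {k} (a : ℚ) (f : Fin k → ℚ) → sumℚ (λ i → a * f i) ≡ a * sumℚ f
  sum-* {zero} a f = sym (*-zeroʳ a)
  sum-* {suc k} a f = trans (cong ((a * f zero) +_) (sum-* a (λ i → f (suc i))))
    (sym (*-distribˡ-+ a (f zero) (sumℚ (λ i → f (suc i)))))

  sum-neg : ∀ {k} (f : Fin k → ℚ) → sumℚ (λ i → - f i) ≡ - sumℚ f
  sum-neg {zero} f = refl
  sum-neg {suc k} f = trans (cong ((- f zero) +_) (sum-neg (λ i → f (suc i))))
    (sym (neg-distrib-+ (f zero) _))

  sum-- : ∀ {k} (f g : Fin k → ℚ) → sumℚ (λ i → f i - g i) ≡ sumℚ f - sumℚ g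
  sum-- f g = trans (sum-+ f (λ i → - g i)) (cong (sumℚ f +_) (sum-neg g))

  sum-swap : ∀ {k m} (f : Fin k → Fin m → ℚ) →
    sumℚ (λ i → sumℚ (λ j → f i j)) ≡ sumℚ (λ j → sumℚ (λ i → f i j))
  sum-swap {zero} {m} f = sym (sum-0 m)
  sum-swap {suc k} {m} f =
    trans (cong (sumℚ (λ j → f zero j) +_) (sum-swap (λ i j → f (suc i) j)))
          (sym (sum-+ (λ j → f zero j) (λ j → sumℚ (λ i → f (suc i) j))))

  sum-mono : ∀ {k} {f g : Fin k → ℚ} → (∀ i → f i ≤ g i) → sumℚ f ≤ sumℚ g
  sum-mono {zero} h = ≤-refl
  sum-mono {suc k} h = +-mono-≤ (h zero) (sum-mono (λ i → h (suc i)))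

  sum-nonneg : ∀ {k} {f : Fin k → ℚ} → (∀ i → 0ℚ ≤ f i) → 0ℚ ≤ sumℚ f
  sum-nonneg {k} h = ≤-trans (≤-reflexive (sym (sum-0 k))) (sum-mono h)

  sum-zero-each : ∀ {k} {f : Fin k → ℚ} → (∀ i → 0ℚ ≤ f i) → sumℚ f ≡ 0ℚ → ∀ i → f i ≡ 0ℚ
  sum-zero-each {suc k} h e zero = nn+nn≡0ˡ (h zero) (sum-nonneg (λ i → h (suc i))) e
  sum-zero-each {suc k} h e (suc i) =
    sum-zero-each (λ i → h (suc i)) (nn+nn≡0ʳ (h zero) (sum-nonneg (λ i → h (suc i))) e) i

  term≤sum : ∀ {k} {f : Fin k → ℚ} → (∀ i → 0ℚ ≤ f i) → ∀ i → f i ≤ sumℚ f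
  term≤sum {suc k} {f} h zero = ≤-trans (≤-reflexive (sym (+-identityʳ (f zero))))
    (+-monoʳ-≤ (f zero) (sum-nonneg (λ i → h (suc i))))
  term≤sum {suc k} {f} h (suc i) = ≤-trans (term≤sum (λ i → h (suc i)) i)
    (≤-trans (≤-reflexive (sym (+-identityˡ _))) (+-monoˡ-≤ _ (h zero)))

  sum-nonzero : ∀ {k} (f : Fin k → ℚ) → sumℚ f ≢ 0ℚ → ∃ λ i → f i ≢ 0ℚ
  sum-nonzero {zero} f ne = ⊥-elim (ne refl)
  sum-nonzero {suc k} f ne with f zero ≟ 0ℚ
  ... | no p = zero , p
  ... | yes p with sum-nonzero (λ i → f (suc i))
        (λ e → ne (trans (cong₂ _+_ p e) refl))
  ... | i , q = suc i , q

  sum-split : ∀ a {b} (h : Fin a ⊎ Fin b → ℚ) →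
    sumℚ (λ i → h (F.splitAt a i)) ≡ sumℚ (λ i → h (inj₁ i)) + sumℚ (λ i → h (inj₂ i))
  sum-split zero h = sym (+-identityˡ _)
  sum-split (suc a) h = trans (cong (h (inj₁ zero) +_) (sum-split a (λ x → h ([ (λ i → inj₁ (suc i)) , inj₂ ]′ x)) ))
    (sym (+-assoc (h (inj₁ zero)) (sumℚ (λ i → h (inj₁ (suc i)))) (sumℚ (λ i → h (inj₂ i)))))

  ini : ∀ {n} → Point (suc n) → Point n
  ini p i = p (F.inject₁ i)

  lst : ∀ {n} → Point (suc n) → ℚ
  lst {n} p = p (F.fromℕ n)

  lift-inj : ∀ {n} (x : Point n) t i → lift x t (F.inject₁ i) ≡ x i
  lift-inj {suc n} x t zero = refl
  lift-inj {suc n} x t (suc i) = lift-inj (λ j → x (suc j)) t i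

  lift-lst : ∀ {n} (x : Point n) t → lift x t (F.fromℕ n) ≡ t
  lift-lst {zero} x t = refl
  lift-lst {suc n} x t = lift-lst (λ j → x (suc j)) t

  ext₂ : ∀ {n} (p q : Point (suc n)) → ini p ≋ ini q → lst p ≡ lst q → p ≋ q
  ext₂ {zero} p q _ e zero = e
  ext₂ {suc n} p q e₁ e₂ zero = e₁ zero
  ext₂ {suc n} p q e₁ e₂ (suc i) = ext₂ (λ j → p (suc j)) (λ j → q (suc j)) (λ j → e₁ (suc j)) e₂ i

  dot-cong : ∀ {n} (c : Point n) {x y : Point n} → x ≋ y → c · x ≡ c · y
  dot-cong c e = sum-cong (λ i → cong (c i *_) (e i))

  dot-congˡ : ∀ {n} {c d : Point n} (x : Point n) → c ≋ d → c · x ≡ d · x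
  dot-congˡ x e = sum-cong (λ i → cong (_* x i) (e i))

  dot-split : ∀ {n} (c p : Point (suc n)) → c · p ≡ ini c · ini p + lst c * lst p
  dot-split {zero} c p = trans (+-identityʳ (c zero * p zero)) (sym (+-identityˡ (c zero * p zero)))
  dot-split {suc n} c p =
    trans (cong (c zero * p zero +_) (dot-split (λ j → c (suc j)) (λ j → p (suc j))))
      (sym (+-assoc (c zero * p zero) (ini (λ j → c (suc j)) · ini (λ j → p (suc j))) (lst (λ j → c (suc j)) * lst (λ j → p (suc j)))))

  dot-lift : ∀ {n} (c : Point (suc n)) x t → c · lift x t ≡ ini c · x + lst c * t
  dot-lift c x t = trans (dot-split c (lift x t))
    (cong₂ (λ a b → a + lst c * b) (dot-cong (ini c) (lift-inj x t)) (lift-lst x t))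

  dot-+ˡ : ∀ {n} (c d x : Point n) → (λ i → c i + d i) · x ≡ c · x + d · x
  dot-+ˡ c d x = trans (sum-cong (λ i → *-distribʳ-+ (x i) (c i) (d i))) (sum-+ (λ i → c i * x i) (λ i → d i * x i))

  dot-*ˡ : ∀ {n} (c x : Point n) a → (λ i → a * c i) · x ≡ a * (c · x)
  dot-*ˡ c x a = trans (sum-cong (λ i → *-assoc a (c i) (x i))) (sum-* a (λ i → c i * x i))

  dot-sum : ∀ {n k} (c : Point n) (λc : Fin k → ℚ) (p : Fin k → Point n) →
    c · (λ i → sumℚ (λ j → λc j * p j i)) ≡ sumℚ (λ j → λc j * (c · p j))
  dot-sum c λc p =
    trans (sum-cong (λ i → sym (sum-* (c i) (λ j → λc j * p j i))))
    (trans (sum-swap (λ i j → c i * (λc j * p j i)))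
     (sum-cong (λ j → trans (sum-cong (λ i → solve 3 (λ c l p → c :* (l :* p) := l :* (c :* p)) refl (c i) (λc j) (p j i)))
                          (sum-* (λc j) (λ i → c i * p j i)))))

  unit : ∀ {n} → Fin n → Point n
  unit zero zero = 1ℚ
  unit zero (suc j) = 0ℚ
  unit (suc i) zero = 0ℚ
  unit (suc i) (suc j) = unit i j

  unit-dot : ∀ {n} (i : Fin n) (x : Point n) → unit i · x ≡ x i
  unit-dot {suc n} zero x = trans (cong₂ _+_ (*-identityˡ (x zero))
       (trans (sum-cong (λ j → *-zeroˡ (x (suc j)))) (sum-0 n))) (+-identityʳ (x zero))
  unit-dot {suc n} (suc i) x = trans (cong₂ _+_ (*-zeroˡ (x zero)) (unit-dot i (λ j → x (suc j)))) (+-identityˡ _)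

  finExt : ∀ {n} {A : Set} (p q : Fin (suc n) → A) → (∀ i → p (F.inject₁ i) ≡ q (F.inject₁ i)) →
    p (F.fromℕ n) ≡ q (F.fromℕ n) → ∀ i → p i ≡ q i
  finExt {zero} p q _ e zero = e
  finExt {suc n} p q e₁ e₂ zero = e₁ zero
  finExt {suc n} p q e₁ e₂ (suc i) = finExt (λ j → p (suc j)) (λ j → q (suc j)) (λ j → e₁ (suc j)) e₂ i

  liftZ : ∀ {n} → LPoint n → ℤ → LPoint (suc n)
  liftZ {zero} x t zero = t
  liftZ {suc n} x t zero = x zero
  liftZ {suc n} x t (suc i) = liftZ (λ j → x (suc j)) t i

  liftZ-inj : ∀ {n} (x : LPoint n) t i → liftZ x t (F.inject₁ i) ≡ x i
  liftZ-inj {suc n} x t zero = refl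
  liftZ-inj {suc n} x t (suc i) = liftZ-inj (λ j → x (suc j)) t i

  liftZ-lst : ∀ {n} (x : LPoint n) t → liftZ x t (F.fromℕ n) ≡ t
  liftZ-lst {zero} x t = refl
  liftZ-lst {suc n} x t = liftZ-lst (λ j → x (suc j)) t

  sumℤ-cong : ∀ {k} {f g : Fin k → ℤ} → (∀ i → f i ≡ g i) → sumℤ f ≡ sumℤ g
  sumℤ-cong {zero} e = refl
  sumℤ-cong {suc k} e = cong₂ ℤ._+_ (e zero) (sumℤ-cong (λ i → e (suc i)))

  sumℤ-zero : ∀ {k} (f : Fin k → ℤ) → (∀ i → f i ≡ ℤ.+ 0) → sumℤ f ≡ ℤ.+ 0
  sumℤ-zero {zero} f e = refl
  sumℤ-zero {suc k} f e = trans (cong₂ ℤ._+_ (e zero) (sumℤ-zero (λ i → f (suc i)) (λ i → e (suc i)))) refl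

  sumℤ-single : ∀ {k} (f : Fin k → ℤ) i₀ → (∀ j → j ≢ i₀ → f j ≡ ℤ.+ 0) → sumℤ f ≡ f i₀
  sumℤ-single {suc k} f zero h = trans (cong (λ z → f zero ℤ.+ z) (sumℤ-zero (λ i → f (suc i)) (λ i → h (suc i) (λ ())))) (ℤP.+-identityʳ (f zero))
  sumℤ-single {suc k} f (suc i₀) h = trans (cong₂ ℤ._+_ (h zero (λ ())) (sumℤ-single (λ i → f (suc i)) i₀ (λ j ne → h (suc j) (λ e → ne (FP.suc-injective e))))) (ℤP.+-identityˡ _)

  sumℤ-*0 : ∀ {k} (b : Fin k → ℤ) → sumℤ (λ i → b i ℤ.* ℤ.+ 0) ≡ ℤ.+ 0
  sumℤ-*0 b = sumℤ-zero _ (λ i → ℤP.*-zeroʳ (b i))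

  unit-abs : ∀ a b → a ℤ.* b ≡ ℤ.+ 1 → ℤ.∣ b ∣ ≡ 1
  unit-abs a b e = ℕP.m*n≡1⇒n≡1 ℤ.∣ a ∣ ℤ.∣ b ∣ (trans (sym (ℤP.abs-* a b)) (cong ℤ.∣_∣ e))

  abs1 : ∀ b → ℤ.∣ b ∣ ≡ 1 → b ≡ ℤ.+ 1 ⊎ b ≡ ℤ.-[1+ 0 ]
  abs1 (ℤ.+ .1) refl = inj₁ refl
  abs1 ℤ.-[1+ .0 ] refl = inj₂ refl

  ε²≡1 : ∀ ε → ℤ.∣ ε ∣ ≡ 1 → ε ℤ.* ε ≡ ℤ.+ 1
  ε²≡1 ε e with abs1 ε e
  ... | inj₁ refl = refl
  ... | inj₂ refl = refl

  div-unit : ∀ m b → ℤ.∣ b ∣ ≡ 1 → ℤ.+ m ℤD.∣ b → m ≡ 1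
  div-unit m b e d = ℕD.∣1⇒≡1 (subst (m ℕD.∣_) e d)

  nonneg-int : ∀ z → ℤ.+ 0 ℤ.≤ z → ∃ λ k → z ≡ ℤ.+ k
  nonneg-int (ℤ.+ k) _ = k , refl

  predInj : ∀ a b → a ≢ 1 → b ≢ 1 → ℕ.pred a ≡ ℕ.pred b → a ≡ b
  predInj zero zero _ _ _ = refl
  predInj zero (suc zero) _ nb _ = ⊥-elim (nb refl)
  predInj zero (suc (suc b)) _ _ ()
  predInj (suc zero) _ na _ _ = ⊥-elim (na refl)
  predInj (suc (suc a)) zero _ _ ()
  predInj (suc (suc a)) (suc zero) _ nb _ = ⊥-elim (nb refl)
  predInj (suc (suc a)) (suc (suc b)) _ _ e = cong suc e

  pred< : ∀ k s → 1 ℕ.≤ s → k ℕ.≤ s → ℕ.pred k ℕ.< s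
  pred< k (suc s) _ k≤ = ℕ.s≤s (ℕP.pred-mono-≤ k≤)

  -- Pigeonhole: among s + 1 distinct natural numbers in [0,s] (s ≥ 1) one equals 1, since
  -- otherwise their predecessors would be s + 1 distinct numbers below s.
  distinct-hits-1 : ∀ s → 1 ℕ.≤ s → (k : Fin (s ℕ.+ 1) → ℕ) → (∀ i → k i ℕ.≤ s) →
    (∀ i j → k i ≡ k j → i ≡ j) → ∃ λ i → k i ≡ 1
  distinct-hits-1 s s≥1 k k≤s kinj with FP.any? (λ i → k i ℕ.≟ 1)
  ... | yes hit = hit
  ... | no none = ⊥-elim (FP.<⇒≢ i<j (kinj i j (predInj (k i) (k j) (λ e → none (i , e)) (λ e → none (j , e))
        (trans (sym (FP.toℕ-fromℕ< (pred< (k i) s s≥1 (k≤s i)))) (trans (cong F.toℕ gij) (FP.toℕ-fromℕ< (pred< (k j) s s≥1 (k≤s j))))))))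
    where
    g : Fin (s ℕ.+ 1) → Fin s
    g i = F.fromℕ< (pred< (k i) s s≥1 (k≤s i))
    s<s+1 : s ℕ.< s ℕ.+ 1
    s<s+1 = subst (s ℕ.<_) (sym (ℕP.+-comm s 1)) (ℕP.n<1+n s)
    ph = FP.pigeonhole s<s+1 g
    i = proj₁ ph
    j = proj₁ (proj₂ ph)
    i<j = proj₁ (proj₂ (proj₂ ph))
    gij : g i ≡ g j
    gij = proj₂ (proj₂ (proj₂ ph))

  ι : ℤ → ℚ
  ι z = z / 1

  ι≡ : ∀ z → ι z ≡ mkℚ z 0 (Cop.sym (Cop.1-coprimeTo ℤ.∣ z ∣))
  ι≡ (ℤ.+ n) = normalize-coprime (Cop.sym (Cop.1-coprimeTo n))
  ι≡ (ℤ.-[1+ n ]) = cong -_ (normalize-coprime (Cop.sym (Cop.1-coprimeTo (suc n))))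

  toU-ι : ∀ z → toℚᵘ (ι z) ≡ mkℚᵘ z 0
  toU-ι z = cong toℚᵘ (ι≡ z)

  ι-+ : ∀ a b → ι (a ℤ.+ b) ≡ ι a + ι b
  ι-+ a b = toℚᵘ-injective (UP.≃-trans (UP.≃-reflexive (toU-ι (a ℤ.+ b)))
     (UP.≃-trans (*≡* eq) (UP.≃-sym (UP.≃-trans (toℚᵘ-homo-+ (ι a) (ι b))
        (UP.≃-reflexive (cong₂ U._+_ (toU-ι a) (toU-ι b)))))))
    where
    eq : (a ℤ.+ b) ℤ.* ℤ.+ 1 ≡ (a ℤ.* ℤ.+ 1 ℤ.+ b ℤ.* ℤ.+ 1) ℤ.* ℤ.+ 1
    eq = ℤS.solve 2 (λ a b → (a ℤS.:+ b) ℤS.:* ℤS.con (ℤ.+ 1) ℤS.:= (a ℤS.:* ℤS.con (ℤ.+ 1) ℤS.:+ b ℤS.:* ℤS.con (ℤ.+ 1)) ℤS.:* ℤS.con (ℤ.+ 1)) refl a b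

  ι-* : ∀ a b → ι (a ℤ.* b) ≡ ι a * ι b
  ι-* a b = toℚᵘ-injective (UP.≃-trans (UP.≃-reflexive (toU-ι (a ℤ.* b)))
     (UP.≃-trans (*≡* eq) (UP.≃-sym (UP.≃-trans (toℚᵘ-homo-* (ι a) (ι b))
        (UP.≃-reflexive (cong₂ U._*_ (toU-ι a) (toU-ι b)))))))
    where
    eq : (a ℤ.* b) ℤ.* ℤ.+ 1 ≡ (a ℤ.* b) ℤ.* ℤ.+ 1
    eq = refl

  ι-neg : ∀ a → ι (ℤ.- a) ≡ - ι a
  ι-neg a = toℚᵘ-injective (UP.≃-trans (UP.≃-reflexive (toU-ι (ℤ.- a)))
     (UP.≃-sym (UP.≃-trans (toℚᵘ-homo‿- (ι a)) (UP.≃-reflexive (cong U.-_ (toU-ι a))))))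

  ι-inj : ∀ {a b} → ι a ≡ ι b → a ≡ b
  ι-inj {a} {b} e with trans (sym (toU-ι a)) (trans (cong toℚᵘ e) (toU-ι b))
  ... | refl = refl

  ι-mono : ∀ {a b} → a ℤ.≤ b → ι a ≤ ι b
  ι-mono {a} {b} a≤b = toℚᵘ-cancel-≤ (subst₂ U._≤_ (sym (toU-ι a)) (sym (toU-ι b))
     (U.*≤* (subst₂ ℤ._≤_ (sym (ℤP.*-identityʳ a)) (sym (ℤP.*-identityʳ b)) a≤b)))

  ι-cancel : ∀ {a b} → ι a ≤ ι b → a ℤ.≤ b
  ι-cancel {a} {b} h with subst₂ U._≤_ (toU-ι a) (toU-ι b) (toℚᵘ-mono-≤ h)
  ... | U.*≤* x = subst₂ ℤ._≤_ (ℤP.*-identityʳ a) (ℤP.*-identityʳ b) x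

  ι-- : ∀ a b → ι (a ℤ.- b) ≡ ι a - ι b
  ι-- a b = trans (ι-+ a (ℤ.- b)) (cong (ι a +_) (ι-neg b))

  σℚ : ℕ → ℚ
  σℚ s = ι (ℤ.+ s)

  σ-pos : ∀ s → 1 ℕ.≤ s → 0ℚ < σℚ s
  σ-pos s h = <-≤-trans 0<1 (ι-mono (ℤ.+≤+ h))

  σ≢0 : ∀ s → 1 ℕ.≤ s → σℚ s ≢ 0ℚ
  σ≢0 s h e = <-irrefl (sym e) (σ-pos s h)

  0≢σ : ∀ s → 1 ℕ.≤ s → 0ℚ ≢ σℚ s
  0≢σ s h e = σ≢0 s h (sym e)

  pos-unit : ∀ σ r b → 0ℚ < σ → 0ℚ < r → σ ≡ r * ι b → (b ≡ ℤ.+ 1 ⊎ b ≡ ℤ.-[1+ 0 ]) → b ≡ ℤ.+ 1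
  pos-unit σ r b σp rp eq (inj₁ e) = e
  pos-unit σ r b σp rp eq (inj₂ refl) = ⊥-elim (<-irrefl refl (<-trans σp (≤-<-trans (≤-reflexive (trans eq (solve 1 (λ r → r :* con (ι (ℤ.-[1+ 0 ])) := :- r) refl r)))
                       (neg-antimono-< rp))))

  diff : ∀ {n} (a b : Point n) → ¬ (a ≋ b) → ∃ λ i → a i ≢ b i
  diff a b ne with FP.any? (λ i → ¬? (a i ≟ b i))
  ... | yes (i , p) = i , p
  ... | no q = ⊥-elim (ne (λ i → decidable-stable (a i ≟ b i) (λ nq → q (i , nq))))

  ≋-refl : ∀ {n} {a : Point n} → a ≋ a
  ≋-refl i = refl

  ≋-sym : ∀ {n} {a b : Point n} → a ≋ b → b ≋ a
  ≋-sym e i = sym (e i)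

  ≋-trans : ∀ {n} {a b c : Point n} → a ≋ b → b ≋ c → a ≋ c
  ≋-trans e f i = trans (e i) (f i)

  seg-r : ∀ {n} (a b : Point n) → Seg a b b
  seg-r a b = 1ℚ , 0≤1 , ≤-refl , λ i → solve 2 (λ a b → b := (con 1ℚ :- con 1ℚ) :* a :+ con 1ℚ :* b) refl (a i) (b i)

  seg-l : ∀ {n} (a b : Point n) → Seg a b a
  seg-l a b = 0ℚ , ≤-refl , 0≤1 , λ i → solve 2 (λ a b → a := (con 1ℚ :- con 0ℚ) :* a :+ con 0ℚ :* b) refl (a i) (b i)

  seg-sym : ∀ {n} {a b x : Point n} → Seg a b x → Seg b a x
  seg-sym {a = a} {b} (t , h0 , h1 , e) = 1ℚ - t , ≤⇒0≤- h1 , 0≤-⇒≤ (≤-trans h0 (≤-reflexive (solve 1 (λ t → t := con 1ℚ :- (con 1ℚ :- t)) refl t))) ,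
    λ i → trans (e i) (solve 3 (λ t a b → (con 1ℚ :- t) :* a :+ t :* b := (con 1ℚ :- (con 1ℚ :- t)) :* b :+ (con 1ℚ :- t) :* a) refl t (a i) (b i))

  seg-≋ : ∀ {n} {a b x y : Point n} → Seg a b x → x ≋ y → Seg a b y
  seg-≋ (t , h0 , h1 , e) xy = t , h0 , h1 , λ i → trans (sym (xy i)) (e i)

  seg-pt : ∀ {n} {a b a' b' : Point n} {x} → a ≋ a' → b ≋ b' → Seg a b x → Seg a' b' x
  seg-pt ea eb (t , h0 , h1 , e) = t , h0 , h1 , λ i → trans (e i) (cong₂ (λ u v → (1ℚ - t) * u + t * v) (ea i) (eb i))

  seg-aa : ∀ {n} {a x : Point n} → Seg a a x → x ≋ a
  seg-aa {a = a} (t , _ , _ , e) i = trans (e i) (solve 2 (λ t a → (con 1ℚ :- t) :* a :+ t :* a := a) refl t (a i))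

  gen : ∀ {n} {S : PSet n} {x} → S x → Conv S x
  gen {x = x} sx = 1 , (λ _ → x) , (λ _ → 1ℚ) , (λ _ → sx) , (λ _ → 0≤1) , refl ,
    λ i → trans (+-identityʳ (1ℚ * x i)) (*-identityˡ (x i))

  conv-≋ : ∀ {n} {S : PSet n} {x y} → Conv S x → x ≋ y → Conv S y
  conv-≋ (k , p , l , m , nn , s , e) xy = k , p , l , m , nn , s , λ i → trans (e i) (xy i)

  conv-mono : ∀ {n} {S T : PSet n} → (∀ {x} → S x → T x) → ∀ {x} → Conv S x → Conv T x
  conv-mono f (k , p , l , m , nn , s , e) = k , p , l , (λ j → f (m j)) , nn , s , e

  split-all : ∀ {a b} {A : Set} (P : A → Set) (f : Fin a → A) (g : Fin b → A) →
    (∀ j → P (f j)) → (∀ j → P (g j)) → ∀ i → P ([ f , g ]′ (F.splitAt a i))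
  split-all {a} P f g hf hg i with F.splitAt a i
  ... | inj₁ j = hf j
  ... | inj₂ j = hg j

  conv-comb : ∀ {n} {S : PSet n} {x y} t → 0ℚ ≤ t → t ≤ 1ℚ → Conv S x → Conv S y →
    Conv S (λ i → (1ℚ - t) * x i + t * y i)
  conv-comb {n} {S} {x} {y} t h0 h1 (k₁ , p₁ , l₁ , m₁ , nn₁ , s₁ , e₁) (k₂ , p₂ , l₂ , m₂ , nn₂ , s₂ , e₂) =
    k₁ ℕ.+ k₂ , (λ i → [ p₁ , p₂ ]′ (F.splitAt k₁ i)) , (λ i → [ L₁ , L₂ ]′ (F.splitAt k₁ i)) ,
    split-all S p₁ p₂ m₁ m₂ ,
    split-all (0ℚ ≤_) L₁ L₂ (λ j → nn*nn (≤⇒0≤- h1) (nn₁ j)) (λ j → nn*nn h0 (nn₂ j)) ,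
    trans (sum-split k₁ [ L₁ , L₂ ]′) (trans (cong₂ _+_ (sum-* (1ℚ - t) l₁) (sum-* t l₂))
       (trans (cong₂ (λ u v → (1ℚ - t) * u + t * v) s₁ s₂) (solve 1 (λ t → (con 1ℚ :- t) :* con 1ℚ :+ t :* con 1ℚ := con 1ℚ) refl t))) ,
    λ i → trans (sum-split k₁ (λ z → [ L₁ , L₂ ]′ z * [ p₁ , p₂ ]′ z i))
      (cong₂ _+_ (trans (sum-cong (λ j → *-assoc (1ℚ - t) (l₁ j) (p₁ j i))) (trans (sum-* (1ℚ - t) (λ j → l₁ j * p₁ j i)) (cong ((1ℚ - t) *_) (e₁ i))))
                 (trans (sum-cong (λ j → *-assoc t (l₂ j) (p₂ j i))) (trans (sum-* t (λ j → l₂ j * p₂ j i)) (cong (t *_) (e₂ i)))))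
    where
    L₁ = λ j → (1ℚ - t) * l₁ j
    L₂ = λ j → t * l₂ j

  conv-dot : ∀ {n} {S : PSet n} (c : Point n) {x} (cx : Conv S x) →
    c · x ≡ sumℚ (λ j → proj₁ (proj₂ (proj₂ cx)) j * (c · proj₁ (proj₂ cx) j))
  conv-dot c (k , p , l , m , nn , s , e) = trans (dot-cong c (λ i → sym (e i))) (dot-sum c l p)

  wsum-lb : ∀ {k} (l : Fin k → ℚ) (a : Fin k → ℚ) m → (∀ j → 0ℚ ≤ l j) → sumℚ l ≡ 1ℚ →
    (∀ j → m ≤ a j) → m ≤ sumℚ (λ j → l j * a j)
  wsum-lb l a m nn s h = ≤-trans (≤-reflexive (trans (sym (*-identityʳ m)) (trans (cong (m *_) (sym s)) (trans (sym (sum-* m l)) (sum-cong (λ j → *-comm m (l j)))))))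
    (sum-mono (λ j → *-monoˡ-≤-nonNeg (l j) {{nonNegative (nn j)}} (h j)))

  conv-lb : ∀ {n} {S : PSet n} (c : Point n) m → (∀ g → S g → m ≤ c · g) → ∀ {x} → Conv S x → m ≤ c · x
  conv-lb {S = S} c m h cx@(k , p , l , mem , nn , s , e) =
    ≤-trans (wsum-lb l (λ j → c · p j) m nn s (λ j → h (p j) (mem j))) (≤-reflexive (sym (conv-dot {S = S} c cx)))

  wsum-eq : ∀ {k} (l : Fin k → ℚ) (a : Fin k → ℚ) m → (∀ j → 0ℚ ≤ l j) → sumℚ l ≡ 1ℚ →
    (∀ j → m ≤ a j) → sumℚ (λ j → l j * a j) ≡ m → ∀ j → l j ≢ 0ℚ → a j ≡ m
  wsum-eq l a m nn s h e j lj≢0 = -≡0⇒≡ (mul-cancel lj≢0 (sum-zero-each τnn τ0 j))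
    where
    τnn : ∀ j → 0ℚ ≤ l j * (a j - m)
    τnn j = nn*nn (nn j) (≤⇒0≤- (h j))
    τ0 : sumℚ (λ j → l j * (a j - m)) ≡ 0ℚ
    τ0 = begin
      sumℚ (λ j → l j * (a j - m)) ≡⟨ sum-cong (λ j → solve 3 (λ l a m → l :* (a :- m) := l :* a :- m :* l) refl (l j) (a j) m) ⟩
      sumℚ (λ j → l j * a j - m * l j) ≡⟨ sum-- (λ j → l j * a j) (λ j → m * l j) ⟩
      sumℚ (λ j → l j * a j) - sumℚ (λ j → m * l j) ≡⟨ cong₂ _-_ e (trans (sum-* m l) (trans (cong (m *_) s) (*-identityʳ m))) ⟩
      m - m ≡⟨ +-inverseʳ m ⟩
      0ℚ ∎
      where open ≡-Reasoning

  nz-weight : ∀ {k} (l : Fin k → ℚ) → sumℚ l ≡ 1ℚ → ∃ λ j → l j ≢ 0ℚ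
  nz-weight l s = sum-nonzero l (λ e → 1≢0 (trans (sym s) e))

  FaceConv→ : ∀ {n} {S : PSet n} (c : Point n) m → (∀ g → S g → m ≤ c · g) →
    ∀ g₀ → S g₀ → c · g₀ ≡ m →
    ∀ {x} → Face c (Conv S) x → Conv (λ g → S g × c · g ≡ m) x
  FaceConv→ {n} {S} c m lb g₀ sg₀ eg₀ {x} (cx@(k , p , l , mem , nn , s , e) , mn) =
    k , p' , l , mem' , nn , s , λ i → trans (sum-cong (λ j → q j i)) (e i)
    where
    cxm : c · x ≡ m
    cxm = ≤-antisym (≤-trans (mn g₀ (gen {S = S} sg₀)) (≤-reflexive eg₀)) (conv-lb {S = S} c m lb cx)
    ej : ∀ j → l j ≢ 0ℚ → c · p j ≡ m
    ej = wsum-eq l (λ j → c · p j) m nn s (λ j → lb (p j) (mem j)) (trans (sym (conv-dot {S = S} c cx)) cxm)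
    p' : Fin k → Point n
    p' j with l j ≟ 0ℚ
    ... | yes _ = g₀
    ... | no _ = p j
    mem' : ∀ j → S (p' j) × c · p' j ≡ m
    mem' j with l j ≟ 0ℚ
    ... | yes _ = sg₀ , eg₀
    ... | no ne = mem j , ej j ne
    q : ∀ j i → l j * p' j i ≡ l j * p j i
    q j i with l j ≟ 0ℚ
    ... | yes z = trans (cong (_* g₀ i) z) (trans (*-zeroˡ (g₀ i)) (sym (trans (cong (_* p j i) z) (*-zeroˡ (p j i)))))
    ... | no _ = refl

  FaceConv← : ∀ {n} {S : PSet n} (c : Point n) m → (∀ g → S g → m ≤ c · g) →
    ∀ {x} → Conv (λ g → S g × c · g ≡ m) x → Face c (Conv S) x
  FaceConv← {S = S} c m lb cx@(k , p , l , mem , nn , s , e) =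
    conv-mono {S = λ g → S g × c · g ≡ m} {T = S} proj₁ cx ,
    λ y cy → ≤-trans (≤-reflexive (trans (conv-dot {S = λ g → S g × c · g ≡ m} c cx) (trans (sum-cong (λ j → cong (l j *_) (proj₂ (mem j))))
       (trans (sum-cong (λ j → *-comm (l j) m)) (trans (sum-* m l) (trans (cong (m *_) s) (*-identityʳ m)))))))
       (conv-lb {S = S} c m lb cy)

  convSeg→ : ∀ {n} {T : PSet n} {a b} → (∀ g → T g → Seg a b g) → ∀ {x} → Conv T x → Seg a b x
  convSeg→ {n} {T} {a} {b} h {x} (k , p , l , mem , nn , s , e) =
    τ , sum-nonneg (λ j → nn*nn (nn j) (t0 j)) ,
    ≤-trans (sum-mono (λ j → ≤-trans (*-monoˡ-≤-nonNeg (l j) {{nonNegative (nn j)}} (t1 j)) (≤-reflexive (*-identityʳ (l j))))) (≤-reflexive s) ,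
    λ i → begin
      x i ≡⟨ sym (e i) ⟩
      sumℚ (λ j → l j * p j i) ≡⟨ sum-cong (λ j → cong (l j *_) (te j i)) ⟩
      sumℚ (λ j → l j * ((1ℚ - t j) * a i + t j * b i)) ≡⟨ sum-cong (λ j → solve 4 (λ l t a b → l :* ((con 1ℚ :- t) :* a :+ t :* b) := l :* a :+ (l :* t) :* (b :- a)) refl (l j) (t j) (a i) (b i)) ⟩
      sumℚ (λ j → l j * a i + (l j * t j) * (b i - a i)) ≡⟨ sum-+ (λ j → l j * a i) (λ j → (l j * t j) * (b i - a i)) ⟩
      sumℚ (λ j → l j * a i) + sumℚ (λ j → (l j * t j) * (b i - a i)) ≡⟨ cong₂ _+_ (trans (sum-cong (λ j → *-comm (l j) (a i))) (trans (sum-* (a i) l) (trans (cong (a i *_) s) (*-identityʳ (a i)))))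
                                                                          (trans (sum-cong (λ j → *-comm (l j * t j) (b i - a i))) (sum-* (b i - a i) (λ j → l j * t j))) ⟩
      a i + (b i - a i) * τ ≡⟨ solve 3 (λ a b τ → a :+ (b :- a) :* τ := (con 1ℚ :- τ) :* a :+ τ :* b) refl (a i) (b i) τ ⟩
      (1ℚ - τ) * a i + τ * b i ∎
    where
    open ≡-Reasoning
    t : Fin k → ℚ
    t j = proj₁ (h (p j) (mem j))
    t0 : ∀ j → 0ℚ ≤ t j
    t0 j = proj₁ (proj₂ (h (p j) (mem j)))
    t1 : ∀ j → t j ≤ 1ℚ
    t1 j = proj₁ (proj₂ (proj₂ (h (p j) (mem j))))
    te : ∀ j i → p j i ≡ (1ℚ - t j) * a i + t j * b i
    te j i = proj₂ (proj₂ (proj₂ (h (p j) (mem j)))) i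
    τ = sumℚ (λ j → l j * t j)

  convSeg← : ∀ {n} {T : PSet n} {a b} → T a → T b → ∀ {x} → Seg a b x → Conv T x
  convSeg← {T = T} {a = a} {b} ta tb (t , h0 , h1 , e) =
    conv-≋ {S = T} (conv-comb {S = T} t h0 h1 (gen {S = T} ta) (gen {S = T} tb)) (λ i → sym (e i))

  posFace : ∀ {n} {S : PSet n} (c : Point n) {x} k (p : Fin k → Point n) l
    (mem : ∀ j → S (p j)) (nn : ∀ j → 0ℚ ≤ l j) (s : sumℚ l ≡ 1ℚ)
    (e : ∀ i → sumℚ (λ j → l j * p j i) ≡ x i) →
    (∀ y → Conv S y → c · x ≤ c · y) → ∀ j → l j ≢ 0ℚ → Face c (Conv S) (p j)
  posFace {S = S} c {x} k p l mem nn s e mn j ne =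
    gen {S = S} (mem j) , λ y cy → ≤-trans (≤-reflexive eq) (mn y cy)
    where
    eq : c · p j ≡ c · x
    eq = wsum-eq l (λ j → c · p j) (c · x) nn s (λ j → mn (p j) (gen {S = S} (mem j)))
           (sym (conv-dot {S = S} c (k , p , l , mem , nn , s , e))) j ne

  vert-gen : ∀ {n} {S : PSet n} (c v : Point n) → (∀ x → Face c (Conv S) x ⇔ (x ≋ v)) →
    ∃ λ g → S g × g ≋ v
  vert-gen {S = S} c v h with from (h v) ≋-refl
  ... | (k , p , l , mem , nn , s , e) , mn with nz-weight l s
  ... | j , ne = p j , mem j , to (h (p j)) (posFace {S = S} c k p l mem nn s e mn j ne)

  -- A convex combination of points of a segment [a,b] (a ≠ b) which equals b puts weight only
  -- on copies of b: compare the coordinate i in which a and b differ, where δ = bᵢ − aᵢ ≠ 0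
  -- and every point p of the segment has δ·(bᵢ − pᵢ) ≥ 0.
  seg-end-extreme : ∀ {n k} {a b : Point n} (p : Fin k → Point n) (l : Fin k → ℚ) → ¬ (a ≋ b) →
    (∀ j → 0ℚ ≤ l j) → sumℚ l ≡ 1ℚ → (∀ i → sumℚ (λ j → l j * p j i) ≡ b i) →
    (∀ j → l j ≢ 0ℚ → Seg a b (p j)) → ∀ j → l j ≢ 0ℚ → p j ≋ b
  seg-end-extreme {n} {k} {a} {b} p l ¬ab nn s e sj j ne = pj≋b
    where
    open ≡-Reasoning
    i : Fin n
    i = proj₁ (diff a b ¬ab)
    δ : ℚ
    δ = b i - a i
    δ≢0 : δ ≢ 0ℚ
    δ≢0 = 1-≢ (proj₂ (diff a b ¬ab))
    q : ∀ j (ne : l j ≢ 0ℚ) → δ * b i - δ * p j i ≡ (1ℚ - proj₁ (sj j ne)) * (δ * δ)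
    q j ne = trans (cong (λ z → δ * b i - δ * z) (proj₂ (proj₂ (proj₂ (sj j ne))) i))
      (solve 3 (λ a b t → (b :- a) :* b :- (b :- a) :* ((con 1ℚ :- t) :* a :+ t :* b) := (con 1ℚ :- t) :* ((b :- a) :* (b :- a))) refl (a i) (b i) (proj₁ (sj j ne)))
    τ : Fin k → ℚ
    τ j = l j * (δ * b i - δ * p j i)
    τnn : ∀ j → 0ℚ ≤ τ j
    τnn j with l j ≟ 0ℚ
    ... | yes z = ≤-reflexive (sym (trans (cong (_* (δ * b i - δ * p j i)) z) (*-zeroˡ (δ * b i - δ * p j i))))
    ... | no ne = nn*nn (nn j) (≤-trans (nn*nn (≤⇒0≤- (proj₁ (proj₂ (proj₂ (sj j ne))))) (sq-nn δ)) (≤-reflexive (sym (q j ne))))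
    τ0 : sumℚ τ ≡ 0ℚ
    τ0 = begin
      sumℚ τ ≡⟨ sum-cong (λ j → solve 4 (λ l d b p → l :* (d :* b :- d :* p) := (d :* b) :* l :- d :* (l :* p)) refl (l j) δ (b i) (p j i)) ⟩
      sumℚ (λ j → (δ * b i) * l j - δ * (l j * p j i)) ≡⟨ sum-- (λ j → (δ * b i) * l j) (λ j → δ * (l j * p j i)) ⟩
      sumℚ (λ j → (δ * b i) * l j) - sumℚ (λ j → δ * (l j * p j i)) ≡⟨ cong₂ _-_ (trans (sum-* (δ * b i) l) (trans (cong ((δ * b i) *_) s) (*-identityʳ (δ * b i)))) (trans (sum-* δ (λ j → l j * p j i)) (cong (δ *_) (e i))) ⟩
      δ * b i - δ * b i ≡⟨ +-inverseʳ (δ * b i) ⟩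
      0ℚ ∎
    t : ℚ
    t = proj₁ (sj j ne)
    1-t≡0 : 1ℚ - t ≡ 0ℚ
    1-t≡0 = mul-cancel (mul-nonzero δ≢0 δ≢0)
      (trans (*-comm (δ * δ) (1ℚ - t)) (trans (sym (q j ne)) (mul-cancel ne (sum-zero-each τnn τ0 j))))
    t≡1 : t ≡ 1ℚ
    t≡1 = sym (-≡0⇒≡ 1-t≡0)
    pj≋b : p j ≋ b
    pj≋b i' = begin
      p j i' ≡⟨ proj₂ (proj₂ (proj₂ (sj j ne))) i' ⟩
      (1ℚ - t) * a i' + t * b i' ≡⟨ cong₂ (λ u v → u * a i' + v * b i') 1-t≡0 t≡1 ⟩
      0ℚ * a i' + 1ℚ * b i' ≡⟨ solve 2 (λ a b → con 0ℚ :* a :+ con 1ℚ :* b := b) refl (a i') (b i') ⟩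
      b i' ∎

  -- The far end b of an edge [a,b] of conv S is a generator: write b as a convex combination
  -- of generators; those with positive weight lie on the edge, hence equal b.
  edge-end : ∀ {n} {S : PSet n} (c a b : Point n) → ¬ (a ≋ b) →
    (∀ x → Face c (Conv S) x ⇔ Seg a b x) → ∃ λ g → S g × g ≋ b
  edge-end {n} {S} c a b ¬ab h = fromFace (from (h b) (seg-r a b))
    where
    fromFace : Face c (Conv S) b → ∃ λ g → S g × g ≋ b
    fromFace ((k , p , l , mem , nn , s , e) , mn) =
      p j , mem j , seg-end-extreme p l ¬ab nn s e onEdge j ne
      where
      onEdge : ∀ j → l j ≢ 0ℚ → Seg a b (p j)
      onEdge j ne = to (h (p j)) (posFace {S = S} c k p l mem nn s e mn j ne)
      j = proj₁ (nz-weight l s)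
      ne = proj₂ (nz-weight l s)

  CayleyGens : ∀ {n} → PSet n → ℚ → PSet n → ℚ → PSet (suc n)
  CayleyGens Pa ha Pb hb g = (∃ λ y → Pa y × g ≋ lift y ha) ⊎ (∃ λ y → Pb y × g ≋ lift y hb)

  lift-≋ : ∀ {n} {x y : Point n} {h h'} → x ≋ y → h ≡ h' → lift x h ≋ lift y h'
  lift-≋ {x = x} {y} {h} {h'} e e' = ext₂ (lift x h) (lift y h')
    (λ i → trans (lift-inj x h i) (trans (e i) (sym (lift-inj y h' i))))
    (trans (lift-lst x h) (trans e' (sym (lift-lst y h'))))

  lift-≋-inv : ∀ {n} {x y : Point n} {h h'} → lift x h ≋ lift y h' → x ≋ y × h ≡ h'
  lift-≋-inv {n} {x} {y} {h} {h'} e =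
    (λ i → trans (sym (lift-inj x h i)) (trans (e (F.inject₁ i)) (lift-inj y h' i))) ,
    trans (sym (lift-lst x h)) (trans (e (F.fromℕ n)) (lift-lst y h'))

  lift-comb : ∀ {n} (x y : Point n) h h' t →
    lift (λ i → (1ℚ - t) * x i + t * y i) ((1ℚ - t) * h + t * h') ≋ (λ i → (1ℚ - t) * lift x h i + t * lift y h' i)
  lift-comb x y h h' t = ext₂ (lift (λ i → (1ℚ - t) * x i + t * y i) ((1ℚ - t) * h + t * h')) (λ i → (1ℚ - t) * lift x h i + t * lift y h' i)
    (λ i → trans (lift-inj (λ i → (1ℚ - t) * x i + t * y i) ((1ℚ - t) * h + t * h') i) (sym (cong₂ (λ u v → (1ℚ - t) * u + t * v) (lift-inj x h i) (lift-inj y h' i))))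
    (trans (lift-lst (λ i → (1ℚ - t) * x i + t * y i) ((1ℚ - t) * h + t * h')) (sym (cong₂ (λ u v → (1ℚ - t) * u + t * v) (lift-lst x h) (lift-lst y h'))))

  comb-hh : ∀ h t → (1ℚ - t) * h + t * h ≡ h
  comb-hh h t = solve 2 (λ h t → (con 1ℚ :- t) :* h :+ t :* h := h) refl h t

  seg-lift : ∀ {n} {x z w : Point n} h → Seg x z w → Seg (lift x h) (lift z h) (lift w h)
  seg-lift {x = x} {z} {w} h (t , h0 , h1 , e) = t , h0 , h1 ,
    λ i → trans (lift-≋ e (sym (comb-hh h t)) i) (lift-comb x z h h t i)

  seg-unlift : ∀ {n} {x z w : Point n} {h h' h''} → Seg (lift x h) (lift z h') (lift w h'') → Seg x z w
  seg-unlift {x = x} {z} {w} {h} {h'} {h''} (t , h0 , h1 , e) = t , h0 , h1 ,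
    λ i → trans (sym (lift-inj w h'' i)) (trans (e (F.inject₁ i)) (cong₂ (λ u v → (1ℚ - t) * u + t * v) (lift-inj x h i) (lift-inj z h' i)))

  seg-last : ∀ {n} {x z w : Point n} {h h' h''} → (sg : Seg (lift x h) (lift z h') (lift w h'')) →
    h'' ≡ (1ℚ - proj₁ sg) * h + proj₁ sg * h'
  seg-last {n} {x} {z} {w} {h} {h'} {h''} (t , h0 , h1 , e) =
    trans (sym (lift-lst w h'')) (trans (e (F.fromℕ n)) (cong₂ (λ u v → (1ℚ - t) * u + t * v) (lift-lst x h) (lift-lst z h')))

  seg-height₀ : ∀ {n} {x z w : Point n} {h h'} → h ≢ h' → Seg (lift x h) (lift z h') (lift w h) → w ≋ x
  seg-height₀ {x = x} {z} {w} {h} {h'} ne sg@(t , h0 , h1 , e) i = begin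
      w i ≡⟨ proj₂ (proj₂ (proj₂ (seg-unlift sg))) i ⟩
      (1ℚ - t) * x i + t * z i ≡⟨ cong (λ u → (1ℚ - u) * x i + u * z i) t0 ⟩
      (1ℚ - 0ℚ) * x i + 0ℚ * z i ≡⟨ solve 2 (λ x z → (con 1ℚ :- con 0ℚ) :* x :+ con 0ℚ :* z := x) refl (x i) (z i) ⟩
      x i ∎
    where
    open ≡-Reasoning
    t0 : t ≡ 0ℚ
    t0 = mul-cancel (1-≢ ne)
         (trans (solve 3 (λ h h' t → (h' :- h) :* t := ((con 1ℚ :- t) :* h :+ t :* h') :- h) refl h h' t)
         (trans (cong (_- h) (sym (seg-last sg))) (+-inverseʳ h)))

  face-≋ : ∀ {n} {P : PSet n} {c x y} → (∀ {x y} → P x → x ≋ y → P y) → Face c P x → x ≋ y → Face c P y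
  face-≋ {c = c} resp (px , mn) xy = resp px xy , λ z pz → ≤-trans (≤-reflexive (sym (dot-cong c xy))) (mn z pz)

  module FloorFaces {n} (CC : PSet (suc n)) (P : PSet n) (h : ℚ)
    (inCC : ∀ y → P y → CC (lift y h)) where

    face-down : ∀ {c x} → P x → Face c CC (lift x h) → Face (ini c) P x
    face-down {c} {x} px (_ , mn) = px , λ y py →
      +-cancelʳ-≤ (lst c * h) (ini c · x) (ini c · y)
        (≤-trans (≤-reflexive (sym (dot-lift c x h))) (≤-trans (mn (lift y h) (inCC y py)) (≤-reflexive (dot-lift c y h))))
      where
      +-cancelʳ-≤ : ∀ r p q → p + r ≤ q + r → p ≤ q
      +-cancelʳ-≤ r p q le = ≤-trans (≤-reflexive (solve 2 (λ p r → p := p :+ r :- r) refl p r))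
        (≤-trans (+-monoˡ-≤ (- r) le) (≤-reflexive (solve 2 (λ q r → q :+ r :- r := q) refl q r)))

    face-up : ∀ {c x y} → P x → Face c CC (lift x h) → Face (ini c) P y → Face c CC (lift y h)
    face-up {c} {x} {y} px fx fy = inCC y (proj₁ fy) , λ z cz → ≤-trans (≤-reflexive e) (proj₂ fx z cz)
      where
      fx' : Face (ini c) P x
      fx' = face-down {c = c} px fx
      e : c · lift y h ≡ c · lift x h
      e = trans (dot-lift c y h) (trans (cong (_+ lst c * h)
            (≤-antisym (proj₂ fy x px) (proj₂ fx' y (proj₁ fy)))) (sym (dot-lift c x h)))

  Resp : ∀ {n} → PSet n → Set
  Resp P = ∀ {x y} → P x → x ≋ y → P y

  module Floor {n} (CC : PSet (suc n)) {SP : PSet n} (h : ℚ)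
    (inCC : ∀ y → Conv SP y → CC (lift y h)) where

    P : PSet n
    P = Conv SP

    open FloorFaces CC P h inCC

    respP : Resp P
    respP = conv-≋ {S = SP}

    vert-side : ∀ {c v x} → (∀ z → Face c CC z ⇔ (z ≋ v)) → P x → v ≋ lift x h → IsVertex P x
    vert-side {c} {v} {x} hv px vX = ini c , λ z → mk⇔ (tz z) (fz z)
      where
      fX : Face c CC (lift x h)
      fX = from (hv (lift x h)) (≋-sym vX)
      tz : ∀ z → Face (ini c) P z → z ≋ x
      tz z fz' = proj₁ (lift-≋-inv (≋-trans (to (hv (lift z h)) (face-up {c = c} px fX fz')) vX))
      fz : ∀ z → z ≋ x → Face (ini c) P z
      fz z zx = face-≋ {P = P} {c = ini c} respP (face-down {c = c} px fX) (≋-sym zx)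

    edge-same : ∀ {c x z} → (∀ y → Face c CC y ⇔ Seg (lift x h) (lift z h) y) → P x → P z →
      ¬ (lift x h ≋ lift z h) → IsEdge P x z
    edge-same {c} {x} {z} H px pz ne = (λ xz → ne (lift-≋ xz refl)) , ini c , λ w → mk⇔ (tw w) (fw w)
      where
      fX : Face c CC (lift x h)
      fX = from (H (lift x h)) (seg-l _ _)
      tw : ∀ w → Face (ini c) P w → Seg x z w
      tw w fw' = seg-unlift (to (H (lift w h)) (face-up {c = c} px fX fw'))
      fw : ∀ w → Seg x z w → Face (ini c) P w
      fw w sw@(t , h0 , h1 , e) = face-down {c = c} pw (from (H (lift w h)) (seg-lift h sw))
        where
        pw : P w
        pw = respP (conv-comb {S = SP} t h0 h1 px pz) (λ i → sym (e i))

    edge-end-face : ∀ {c x z h'} → (∀ y → Face c CC y ⇔ Seg (lift x h) (lift z h') y) → h ≢ h' → P x →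
      ∀ w → Face (ini c) P w ⇔ (w ≋ x)
    edge-end-face {c} {x} {z} {h'} H ne px w = mk⇔ tw fw
      where
      fX : Face c CC (lift x h)
      fX = from (H (lift x h)) (seg-l _ _)
      tw : Face (ini c) P w → w ≋ x
      tw fw' = seg-height₀ ne (to (H (lift w h)) (face-up {c = c} px fX fw'))
      fw : w ≋ x → Face (ini c) P w
      fw wx = face-≋ {P = P} {c = ini c} respP (face-down {c = c} px fX) (≋-sym wx)

  seg-sym⇔ : ∀ {m} {Q : PSet m} {a b} → (∀ y → Q y ⇔ Seg a b y) → ∀ y → Q y ⇔ Seg b a y
  seg-sym⇔ H y = mk⇔ (λ q → seg-sym (to (H y) q)) (λ sg → from (H y) (seg-sym sg))

  seg-pt⇔ : ∀ {m} {Q : PSet m} {a b a' b'} → a ≋ a' → b ≋ b' → (∀ y → Q y ⇔ Seg a b y) → ∀ y → Q y ⇔ Seg a' b' y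
  seg-pt⇔ ea eb H y = mk⇔ (λ q → seg-pt ea eb (to (H y) q)) (λ sg → from (H y) (seg-pt (≋-sym ea) (≋-sym eb) sg))

  Fan : ∀ {n} → PSet n → PSet n → Set
  Fan Pa Pb = ∀ c₀ → ∃ λ c₁ → ∀ c → NormalCone Pa c₀ c ⇔ NormalCone Pb c₁ c

  fan-unique : ∀ {n} {Pa Pb : PSet n} → Fan Pa Pb → (∀ c → ∃ λ u → Face c Pb u) →
    ∀ {c d x y y'} → (∀ w → Face c Pa w ⇔ (w ≋ x)) → (∀ w → Face d Pa w ⇔ (w ≋ x)) →
    (∀ w → Face c Pb w ⇔ (w ≋ y)) → (∀ w → Face d Pb w ⇔ (w ≋ y')) → y ≋ y'
  fan-unique {Pa = Pa} {Pb} fan ne {c} {d} Hca Hda Hcb Hdb = ≋-trans (≋-sym (to (Hcb u) (n1 u fu))) (to (Hdb u) (n2 u fu))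
    where
    c₁ = proj₁ (fan c)
    eq = proj₂ (fan c)
    n1 : NormalCone Pb c₁ c
    n1 = to (eq c) (λ w f → f)
    n2 : NormalCone Pb c₁ d
    n2 = to (eq d) (λ w f → from (Hda w) (to (Hca w) f))
    u = proj₁ (ne c₁)
    fu = proj₂ (ne c₁)

  vert⇔seg : ∀ {m} {Q : PSet m} {x} → (∀ w → Q w ⇔ (w ≋ x)) → ∀ w → Q w ⇔ Seg x x w
  vert⇔seg {x = x} H w = mk⇔ (λ f → seg-≋ (seg-l x x) (≋-sym (to (H w) f))) (λ sg → from (H w) (seg-aa sg))

  seg⇔vert : ∀ {m} {Q : PSet m} {x} → (∀ w → Q w ⇔ Seg x x w) → ∀ w → Q w ⇔ (w ≋ x)
  seg⇔vert {x = x} H w = mk⇔ (λ f → seg-aa (to (H w) f)) (λ wx → from (H w) (seg-≋ (seg-l x x) (≋-sym wx)))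

  argmin : ∀ {k} → Fin k → (f : Fin k → ℚ) → ∃ λ j → ∀ i → f j ≤ f i
  argmin {suc zero} zero f = zero , λ { zero → ≤-refl }
  argmin {suc (suc k)} _ f with argmin {suc k} zero (λ i → f (suc i))
  ... | j , hj with f zero ≤? f (suc j)
  ... | yes p = zero , λ { zero → ≤-refl ; (suc i) → ≤-trans p (hj i) }
  ... | no p = suc j , λ { zero → <⇒≤ (≰⇒> p) ; (suc i) → hj i }
  argmin {suc zero} (suc ()) f

  LGen : ∀ {n k} → (Fin k → LPoint n) → PSet n
  LGen V x = ∃ λ j → x ≋ toℚ (V j)

  lp-inhabited : ∀ {n k} (V : Fin k → LPoint n) {x} → LatticePolytope V x → Fin k
  lp-inhabited V (zero , p , l , mem , nn , s , e) = ⊥-elim (1≢0 (sym s))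
  lp-inhabited V (suc k , p , l , mem , nn , s , e) = proj₁ (mem zero)

  face-nonempty : ∀ {n k} (V : Fin k → LPoint n) → Fin k → ∀ c → ∃ λ u → Face c (LatticePolytope V) u
  face-nonempty V j₀ c with argmin j₀ (λ j → c · toℚ (V j))
  ... | j , hj = toℚ (V j) , gen {S = LGen V} (j , ≋-refl) ,
    λ y py → conv-lb {S = LGen V} c (c · toℚ (V j)) (λ g (i , gi) → ≤-trans (hj i) (≤-reflexive (sym (dot-cong c gi)))) py

  lattice-vertex : ∀ {n k} (V : Fin k → LPoint n) {c x} → (∀ w → Face c (LatticePolytope V) w ⇔ (w ≋ x)) →
    ∃ λ j → x ≋ toℚ (V j)
  lattice-vertex V {c} {x} H = fromGenerator (vert-gen {S = LGen V} c x H)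
    where
    fromGenerator : (∃ λ g → LGen V g × g ≋ x) → ∃ λ j → x ≋ toℚ (V j)
    fromGenerator (g , (j , gj) , gx) = j , ≋-trans (≋-sym gx) gj

  dot-lift-lift : ∀ {n} (c : Point n) M y h → lift c M · lift y h ≡ c · y + M * h
  dot-lift-lift c M y h = trans (dot-lift (lift c M) y h) (cong₂ (λ a b → a + b * h) (dot-congˡ y (lift-inj c M)) (lift-lst c M))

  faceSeg : ∀ {m} {S : PSet m} (c : Point m) mm {a b} → (∀ g → S g → mm ≤ c · g) →
    (∀ g → S g → c · g ≡ mm → Seg a b g) → S a → c · a ≡ mm → S b → c · b ≡ mm →
    ∀ y → Face c (Conv S) y ⇔ Seg a b y
  faceSeg {S = S} c mm {a} {b} lb hs sa ea sb eb y = mk⇔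
    (λ fy → convSeg→ {T = λ g → S g × c · g ≡ mm} (λ g (sg , eg) → hs g sg eg) (FaceConv→ {S = S} c mm lb a sa ea fy))
    (λ sy → FaceConv← {S = S} c mm lb (convSeg← {T = λ g → S g × c · g ≡ mm} (sa , ea) (sb , eb) sy))

  lp-lb : ∀ {n k} (V : Fin k → LPoint n) (c : Point n) → ∀ z → LatticePolytope V z →
    - sumℚ (λ j → ∣ c · toℚ (V j) ∣) ≤ c · z
  lp-lb V c z pz = conv-lb {S = LGen V} c (- sumℚ (λ j → ∣ c · toℚ (V j) ∣)) (λ g (j , gj) →
    ≤-trans (neg-antimono-≤ (term≤sum (λ j → abs-nn (c · toℚ (V j))) j))
    (≤-trans (neg-abs-le (c · toℚ (V j))) (≤-reflexive (sym (dot-cong c gj))))) pz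

  dot-perturb : ∀ {n} (c : Point n) K i z → (λ l → K * c l + unit i l) · z ≡ K * (c · z) + z i
  dot-perturb c K i z = trans (dot-+ˡ (λ l → K * c l) (unit i) z) (cong₂ _+_ (dot-*ˡ c z K) (unit-dot i z))

  -- Perturbing the normal of a vertex: if c exposes the vertex x of conv V, then for each
  -- coordinate i, K·c + eᵢ with K ≥ 0 large enough still attains its minimum at x, since at
  -- every generator either c is larger than at x or the generator is x itself.
  perturbNormal : ∀ {n k} (V : Fin k → LPoint n) {c x} → (∀ w → Face c (LatticePolytope V) w ⇔ (w ≋ x)) →
    (i : Fin n) → ∃ λ K → Face (λ l → K * c l + unit i l) (LatticePolytope V) x
  perturbNormal {n} {k} V {c} {x} Hx i = K , fxK
    where
    fx : Face c (LatticePolytope V) x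
    fx = from (Hx x) ≋-refl
    a : Fin k → ℚ
    a j = c · toℚ (V j) - c · x
    b : Fin k → ℚ
    b j = toℚ (V j) i - x i
    r : Fin k → ℚ
    r j = ∣ b j ∣ * inv (a j)
    a-nn : ∀ j → 0ℚ ≤ a j
    a-nn j = ≤⇒0≤- (proj₂ fx (toℚ (V j)) (gen {S = LGen V} (j , ≋-refl)))
    r-nn : ∀ j → 0ℚ ≤ r j
    r-nn j = nn*nn (abs-nn (b j)) (inv-nn (a j) (a-nn j))
    K = sumℚ r
    cK : Point n
    cK l = K * c l + unit i l
    key : ∀ j → 0ℚ ≤ K * a j + b j
    key j with a j ≟ 0ℚ
    ... | yes a0 = ≤-reflexive (sym (trans (cong₂ (λ u v → K * u + v) a0 b0) (solve 1 (λ K → K :* con 0ℚ :+ con 0ℚ := con 0ℚ) refl K)))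
      where
      Vx : toℚ (V j) ≋ x
      Vx = to (Hx (toℚ (V j))) (gen {S = LGen V} (j , ≋-refl) ,
             λ z pz → ≤-trans (≤-reflexive (-≡0⇒≡ a0)) (proj₂ fx z pz))
      b0 : b j ≡ 0ℚ
      b0 = trans (cong (_- x i) (Vx i)) (+-inverseʳ (x i))
    ... | no ane = ≤-trans (≤-trans (≤-reflexive (sym (+-inverseʳ (b j))))
                            (+-monoʳ-≤ (b j) (abs-ge-neg (b j))))
                    (≤-trans (≤-reflexive (+-comm (b j) ∣ b j ∣))
                      (+-monoˡ-≤ (b j) (≤-trans (≤-reflexive (sym rb))
                        (*-monoʳ-≤-nonNeg (a j) {{nonNegative (a-nn j)}} (term≤sum r-nn j)))))
      where
      rb : r j * a j ≡ ∣ b j ∣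
      rb = trans (*-assoc ∣ b j ∣ (inv (a j)) (a j)) (trans (cong (∣ b j ∣ *_) (invl (a j) ane)) (*-identityʳ ∣ b j ∣))
    fxK : Face cK (LatticePolytope V) x
    fxK = proj₁ fx , λ z pz → conv-lb {S = LGen V} cK (cK · x) (λ g (j , gj) →
      ≤-trans (≤-reflexive (dot-perturb c K i x)) (≤-trans (0≤-⇒≤ (≤-trans (key j) (≤-reflexive
        (solve 5 (λ K V x Vi xi → K :* (V :- x) :+ (Vi :- xi) := (K :* V :+ Vi) :- (K :* x :+ xi)) refl K (c · toℚ (V j)) (c · x) (toℚ (V j) i) (x i)))))
        (≤-reflexive (sym (trans (dot-cong cK gj) (dot-perturb c K i (toℚ (V j)))))))) pz

  module CayleyHull {n ka kb} (Va : Fin ka → LPoint n) (Vb : Fin kb → LPoint n) (ha hb : ℚ) (hne : ha ≢ hb) where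

    Pa = LatticePolytope Va
    Pb = LatticePolytope Vb
    SG = CayleyGens Pa ha Pb hb
    CC = Conv SG

    inA : ∀ y → Pa y → CC (lift y ha)
    inA y py = gen {S = SG} (inj₁ (y , py , ≋-refl))
    inB : ∀ y → Pb y → CC (lift y hb)
    inB y py = gen {S = SG} (inj₂ (y , py , ≋-refl))

    d≢0 : hb - ha ≢ 0ℚ
    d≢0 = 1-≢ hne

    module Bottom = Floor CC {LGen Va} ha inA
    module Top = Floor CC {LGen Vb} hb inB

    steepTilt : ∀ (c' x : Point n) → ∃ λ M → ∀ y → Pb y → (c' · x + M * ha) + 1ℚ ≤ lift c' M · lift y hb
    steepTilt c' x = M , strictB
      where
      Σb = sumℚ (λ j → ∣ c' · toℚ (Vb j) ∣)
      B = Σb + ∣ c' · x ∣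
      M : ℚ
      M = (B + 1ℚ) * (1/ (hb - ha)) {{≢-nonZero d≢0}}
      keyM : M * hb - M * ha ≡ B + 1ℚ
      keyM = trans (solve 3 (λ M a b → M :* b :- M :* a := M :* (b :- a)) refl M ha hb) (inv-mul (hb - ha) (B + 1ℚ) d≢0)
      strictB : ∀ y → Pb y → (c' · x + M * ha) + 1ℚ ≤ lift c' M · lift y hb
      strictB y py = ≤-trans (le-by A Bv hA hB eq) (≤-reflexive (sym (dot-lift-lift c' M y hb)))
        where
        A = c' · y - - Σb
        Bv = ∣ c' · x ∣ - c' · x
        hA : 0ℚ ≤ A
        hA = ≤⇒0≤- (lp-lb Vb c' y py)
        hB : 0ℚ ≤ Bv
        hB = ≤⇒0≤- (abs-ge (c' · x))
        eq : (c' · y + M * hb) - ((c' · x + M * ha) + 1ℚ) ≡ A + Bv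
        eq = trans (solve 6 (λ cy cx Mha Mhb S Ax → (cy :+ Mhb) :- (cx :+ Mha :+ con 1ℚ) := ((cy :- (:- S)) :+ (Ax :- cx)) :+ ((Mhb :- Mha) :- (S :+ Ax :+ con 1ℚ)))
                      refl (c' · y) (c' · x) (M * ha) (M * hb) Σb ∣ c' · x ∣)
             (trans (cong (λ z → (A + Bv) + z) (trans (cong (_- (B + 1ℚ)) keyM) (+-inverseʳ (B + 1ℚ)))) (+-identityʳ (A + Bv)))

    -- An edge (or vertex) [x,u] of Pa lifts to a face of CC: the steeply tilted normal
    -- (c',M) is minimised on (Pa, ha) exactly along [x,u] and is larger on (Pb, hb).
    liftedFace : ∀ {c' x u} → (∀ w → Face c' Pa w ⇔ Seg x u w) →
      ∃ λ c → ∀ y → Face c CC y ⇔ Seg (lift x ha) (lift u ha) y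
    liftedFace {c'} {x} {u} HF = lift c' M , faceSeg {S = SG} (lift c' M) mm lb hs (inj₁ (x , px , ≋-refl)) ex (inj₁ (u , pu , ≋-refl)) eu
      where
      fx : Face c' Pa x
      fx = from (HF x) (seg-l x u)
      fu : Face c' Pa u
      fu = from (HF u) (seg-r x u)
      px = proj₁ fx
      pu = proj₁ fu
      M = proj₁ (steepTilt c' x)
      strictB = proj₂ (steepTilt c' x)
      mm = c' · x + M * ha
      ex : lift c' M · lift x ha ≡ mm
      ex = dot-lift-lift c' M x ha
      eu : lift c' M · lift u ha ≡ mm
      eu = trans (dot-lift-lift c' M u ha) (cong (_+ M * ha) (≤-antisym (proj₂ fu x px) (proj₂ fx u pu)))
      lowA : ∀ y → Pa y → mm ≤ lift c' M · lift y ha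
      lowA y py = ≤-trans (+-monoˡ-≤ (M * ha) (proj₂ fx y py)) (≤-reflexive (sym (dot-lift-lift c' M y ha)))
      lb : ∀ g → SG g → mm ≤ lift c' M · g
      lb g (inj₁ (y , py , gy)) = ≤-trans (lowA y py) (≤-reflexive (sym (dot-cong (lift c' M) gy)))
      lb g (inj₂ (y , py , gy)) = ≤-trans (<⇒≤ (<+1 mm)) (≤-trans (strictB y py) (≤-reflexive (sym (dot-cong (lift c' M) gy))))
      hs : ∀ g → SG g → lift c' M · g ≡ mm → Seg (lift x ha) (lift u ha) g
      hs g (inj₁ (y , py , gy)) eg = seg-≋ (seg-lift ha (to (HF y) fy)) (≋-sym gy)
        where
        cy : c' · y ≡ c' · x
        cy = +-cancelʳ-≡ (M * ha) (trans (sym (dot-lift-lift c' M y ha)) (trans (sym (dot-cong (lift c' M) gy)) eg))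
        fy : Face c' Pa y
        fy = py , λ z pz → ≤-trans (≤-reflexive cy) (proj₂ fx z pz)
      hs g (inj₂ (y , py , gy)) eg = ⊥-elim (<-irrefl refl (<-≤-trans (<+1 mm)
          (≤-trans (strictB y py) (≤-reflexive (trans (sym (dot-cong (lift c' M) gy)) eg)))))

  module CayleyEdges {n ka kb} (Va : Fin ka → LPoint n) (Vb : Fin kb → LPoint n) (ha hb : ℚ) (hne : ha ≢ hb) where
    open CayleyHull Va Vb ha hb hne

    respA : Resp Pa
    respA = conv-≋ {S = LGen Va}
    respB : Resp Pb
    respB = conv-≋ {S = LGen Vb}

    upEdge : ∀ {c' x y} → (∀ w → Face c' Pa w ⇔ (w ≋ x)) → (∀ w → Face c' Pb w ⇔ (w ≋ y)) →
      ∃ λ c → ∀ z → Face c CC z ⇔ Seg (lift x ha) (lift y hb) z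
    upEdge {c'} {x} {y} Hx Hy = lift c' ct , faceSeg {S = SG} (lift c' ct) mm lb hs (inj₁ (x , px , ≋-refl)) ex (inj₂ (y , py , ≋-refl)) ey
      where
      fx : Face c' Pa x
      fx = from (Hx x) ≋-refl
      fy : Face c' Pb y
      fy = from (Hy y) ≋-refl
      px = proj₁ fx
      py = proj₁ fy
      ct : ℚ
      ct = (c' · x - c' · y) * (1/ (hb - ha)) {{≢-nonZero d≢0}}
      mm = c' · x + ct * ha
      ex : lift c' ct · lift x ha ≡ mm
      ex = dot-lift-lift c' ct x ha
      ey : lift c' ct · lift y hb ≡ mm
      ey = trans (dot-lift-lift c' ct y hb) (trans (solve 5 (λ cy cx ct a b → cy :+ ct :* b := cy :+ ct :* (b :- a) :+ ct :* a) refl (c' · y) (c' · x) ct ha hb)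
             (trans (cong (λ z → c' · y + z + ct * ha) (inv-mul (hb - ha) (c' · x - c' · y) d≢0))
             (solve 3 (λ cy cx r → cy :+ (cx :- cy) :+ r := cx :+ r) refl (c' · y) (c' · x) (ct * ha))))
      lb : ∀ g → SG g → mm ≤ lift c' ct · g
      lb g (inj₁ (z , pz , gz)) = ≤-trans (+-monoˡ-≤ (ct * ha) (proj₂ fx z pz))
        (≤-reflexive (sym (trans (dot-cong (lift c' ct) gz) (dot-lift-lift c' ct z ha))))
      lb g (inj₂ (z , pz , gz)) = ≤-trans (≤-reflexive (sym ey)) (≤-trans (≤-reflexive (dot-lift-lift c' ct y hb))
        (≤-trans (+-monoˡ-≤ (ct * hb) (proj₂ fy z pz)) (≤-reflexive (sym (trans (dot-cong (lift c' ct) gz) (dot-lift-lift c' ct z hb))))))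
      hs : ∀ g → SG g → lift c' ct · g ≡ mm → Seg (lift x ha) (lift y hb) g
      hs g (inj₁ (z , pz , gz)) eg = seg-≋ (seg-l _ _) (≋-trans (lift-≋ (≋-sym zx) refl) (≋-sym gz))
        where
        cz : c' · z ≡ c' · x
        cz = +-cancelʳ-≡ (ct * ha) (trans (sym (dot-lift-lift c' ct z ha)) (trans (sym (dot-cong (lift c' ct) gz)) eg))
        zx : z ≋ x
        zx = to (Hx z) (pz , λ w pw → ≤-trans (≤-reflexive cz) (proj₂ fx w pw))
      hs g (inj₂ (z , pz , gz)) eg = seg-≋ (seg-r _ _) (≋-trans (lift-≋ (≋-sym zy) refl) (≋-sym gz))
        where
        cz : c' · z ≡ c' · y
        cz = +-cancelʳ-≡ (ct * hb) (trans (sym (dot-lift-lift c' ct z hb)) (trans (sym (dot-cong (lift c' ct) gz)) (trans eg (sym ey'))))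
          where
          ey' : c' · y + ct * hb ≡ mm
          ey' = trans (sym (dot-lift-lift c' ct y hb)) ey
        zy : z ≋ y
        zy = to (Hy z) (pz , λ w pw → ≤-trans (≤-reflexive cz) (proj₂ fy w pw))

    corrVertex : Fan Pb Pa → Fin kb → ∀ {c' x} → (∀ w → Face c' Pa w ⇔ (w ≋ x)) →
      ∃ λ y → ∀ w → Face c' Pb w ⇔ (w ≋ y)
    corrVertex fanBA jb {c'} {x} Hx = y , λ w → mk⇔ (λ fw i → ≤-antisym (coord fw fy i) (coord fy fw i)) (λ wy → face-≋ {P = Pb} {c = c'} respB fy (≋-sym wy))
      where
      c₀ = proj₁ (fanBA c')
      eq = proj₂ (fanBA c')
      ncA : NormalCone Pa c₀ c'
      ncA = to (eq c') (λ w f → f)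
      inc : ∀ c → Face c Pa x → ∀ w → Face c' Pb w → Face c Pb w
      inc c fc = from (eq c) (λ w fw → face-≋ {P = Pa} {c = c} respA fc (≋-sym (to (Hx w) (ncA w fw))))
      y = proj₁ (face-nonempty Vb jb c')
      fy = proj₂ (face-nonempty Vb jb c')
      -- The coordinates of two points of the c'-face of Pb agree: the perturbed functional
      -- K·c' + eᵢ still exposes x in Pa, so its face on Pb lies in the c'-face, where it is
      -- minimised in the i-th coordinate.
      coord : ∀ {y₁ y₂} → Face c' Pb y₁ → Face c' Pb y₂ → ∀ i → y₁ i ≤ y₂ i
      coord {y₁} {y₂} f₁ f₂ i = fromPerturbed (perturbNormal Va Hx i)
        where
        fromPerturbed : (∃ λ K → Face (λ l → K * c' l + unit i l) Pa x) → y₁ i ≤ y₂ i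
        fromPerturbed (K , fxK) = +-cancelˡ-≤' (K * (c' · y₁))
          (≤-trans (≤-reflexive (sym (dot-perturb c' K i y₁))) (≤-trans (proj₂ (inc (λ l → K * c' l + unit i l) fxK y₁ f₁) y₂ (proj₁ f₂))
             (≤-reflexive (trans (dot-perturb c' K i y₂) (cong (λ z → K * z + y₂ i) (≤-antisym (proj₂ f₂ y₁ (proj₁ f₁)) (proj₂ f₁ y₂ (proj₁ f₂))))))))

  seg-point-at-height : ∀ {n} (σ : ℚ) (xz wz : LPoint n) {x y : Point n} → x ≋ toℚ xz →
    (∀ l → y l ≡ x l + σ * ι (wz l)) → ∀ t (k : ℤ) → t * σ ≡ ι k →
    ∀ i → (1ℚ - t) * lift x 0ℚ i + t * lift y σ i ≡ ι (liftZ (λ l → xz l ℤ.+ k ℤ.* wz l) k i)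
  seg-point-at-height {n} σ xz wz {x} {y} xX yY t k tk = finExt (λ i → (1ℚ - t) * lift x 0ℚ i + t * lift y σ i) (λ i → ι (liftZ (λ l → xz l ℤ.+ k ℤ.* wz l) k i))
    (λ i → begin
      (1ℚ - t) * lift x 0ℚ (F.inject₁ i) + t * lift y σ (F.inject₁ i) ≡⟨ cong₂ (λ u v → (1ℚ - t) * u + t * v) (trans (lift-inj x 0ℚ i) (xX i)) (trans (lift-inj y σ i) (trans (yY i) (cong (_+ σ * ι (wz i)) (xX i)))) ⟩
      (1ℚ - t) * ι (xz i) + t * (ι (xz i) + σ * ι (wz i)) ≡⟨ solve 4 (λ t x σ w → (con 1ℚ :- t) :* x :+ t :* (x :+ σ :* w) := x :+ (t :* σ) :* w) refl t (ι (xz i)) σ (ι (wz i)) ⟩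
      ι (xz i) + (t * σ) * ι (wz i) ≡⟨ cong (λ u → ι (xz i) + u * ι (wz i)) tk ⟩
      ι (xz i) + ι k * ι (wz i) ≡⟨ sym (trans (ι-+ (xz i) (k ℤ.* wz i)) (cong (ι (xz i) +_) (ι-* k (wz i)))) ⟩
      ι (xz i ℤ.+ k ℤ.* wz i) ≡⟨ cong ι (sym (liftZ-inj (λ l → xz l ℤ.+ k ℤ.* wz l) k i)) ⟩
      ι (liftZ (λ l → xz l ℤ.+ k ℤ.* wz l) k (F.inject₁ i)) ∎)
    (begin
      (1ℚ - t) * lift x 0ℚ (F.fromℕ n) + t * lift y σ (F.fromℕ n) ≡⟨ cong₂ (λ u v → (1ℚ - t) * u + t * v) (lift-lst x 0ℚ) (lift-lst y σ) ⟩
      (1ℚ - t) * 0ℚ + t * σ ≡⟨ solve 2 (λ t σ → (con 1ℚ :- t) :* con 0ℚ :+ t :* σ := t :* σ) refl t σ ⟩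
      t * σ ≡⟨ tk ⟩
      ι k ≡⟨ cong ι (sym (liftZ-lst (λ l → xz l ℤ.+ k ℤ.* wz l) k)) ⟩
      ι (liftZ (λ l → xz l ℤ.+ k ℤ.* wz l) k (F.fromℕ n)) ∎)
    where open ≡-Reasoning

  -- If y − x = s·W with x, W integral, the segment [(x,0),(y,s)] contains exactly the
  -- s + 1 lattice points (x + kW, k) for k = 0, …, s.
  divisible⇒latticeCount : ∀ {n} (s : ℕ) → 1 ℕ.≤ s → (xz wz : LPoint n) {x y : Point n} →
    x ≋ toℚ xz → (∀ l → y l ≡ x l + σℚ s * ι (wz l)) → LatticeCount (lift x 0ℚ) (lift y (σℚ s)) (s ℕ.+ 1)
  divisible⇒latticeCount {n} s s≥1 xz wz {x} {y} xX yY = f , finj , fseg , fcomp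
    where
    σ = σℚ s
    ne : σ ≢ 0ℚ
    ne = σ≢0 s s≥1
    iσ : ℚ
    iσ = (1/ σ) {{≢-nonZero ne}}
    iσ-nn : 0ℚ ≤ iσ
    iσ-nn = nonNegative⁻¹ iσ {{pos⇒nonNeg iσ {{1/pos⇒pos σ {{positive (σ-pos s s≥1)}}}}}}
    s+1≡ : s ℕ.+ 1 ≡ suc s
    s+1≡ = ℕP.+-comm s 1
    mz : Fin (s ℕ.+ 1) → ℤ
    mz m = ℤ.+ F.toℕ m
    f : Fin (s ℕ.+ 1) → LPoint (suc n)
    f m = liftZ (λ l → xz l ℤ.+ mz m ℤ.* wz l) (mz m)
    finj : ∀ i j → f i ≋ℤ f j → i ≡ j
    finj i j e = FP.toℕ-injective (ℤP.+-injective (trans (sym (liftZ-lst (λ l → xz l ℤ.+ mz i ℤ.* wz l) (mz i))) (trans (e (F.fromℕ n)) (liftZ-lst (λ l → xz l ℤ.+ mz j ℤ.* wz l) (mz j)))))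
    coordEq = seg-point-at-height σ xz wz xX yY
    fseg : ∀ m → Seg (lift x 0ℚ) (lift y σ) (toℚ (f m))
    fseg m = t , nn*nn (ι-mono {ℤ.+ 0} {mz m} (ℤ.+≤+ ℕ.z≤n)) iσ-nn ,
      ≤-trans (*-monoʳ-≤-nonNeg iσ {{nonNegative iσ-nn}} (ι-mono (ℤ.+≤+ m≤s))) (≤-reflexive (*-inverseʳ σ {{≢-nonZero ne}})) ,
      λ i → sym (coordEq t (mz m) (inv-mul σ (ι (mz m)) ne) i)
      where
      t = ι (mz m) * iσ
      m≤s : F.toℕ m ℕ.≤ s
      m≤s = ℕP.m<1+n⇒m≤n (subst (F.toℕ m ℕ.<_) s+1≡ (FP.toℕ<n m))
    fcomp : ∀ (z : LPoint (suc n)) → Seg (lift x 0ℚ) (lift y σ) (toℚ z) → ∃ λ i → z ≋ℤ f i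
    fcomp z (t , h0 , h1 , e) = m , λ i → ι-inj (trans (e i) (trans (coordEq t (ℤ.+ k) tk i)
        (cong (λ u → ι (liftZ (λ l → xz l ℤ.+ u ℤ.* wz l) u i)) (cong ℤ.+_ (sym (FP.toℕ-fromℕ< k<))))))
      where
      zl = z (F.fromℕ n)
      ezl : ι zl ≡ t * σ
      ezl = trans (e (F.fromℕ n)) (trans (cong₂ (λ u v → (1ℚ - t) * u + t * v) (lift-lst x 0ℚ) (lift-lst y σ))
              (solve 2 (λ t σ → (con 1ℚ :- t) :* con 0ℚ :+ t :* σ := t :* σ) refl t σ))
      zl≥0 : ℤ.+ 0 ℤ.≤ zl
      zl≥0 = ι-cancel (≤-trans (nn*nn h0 (<⇒≤ (σ-pos s s≥1))) (≤-reflexive (sym ezl)))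
      k = proj₁ (nonneg-int zl zl≥0)
      zk : zl ≡ ℤ.+ k
      zk = proj₂ (nonneg-int zl zl≥0)
      tk : t * σ ≡ ι (ℤ.+ k)
      tk = trans (sym ezl) (cong ι zk)
      k≤s : k ℕ.≤ s
      k≤s = ℤP.drop‿+≤+ (ι-cancel (≤-trans (≤-reflexive (sym tk)) (≤-trans (*-monoʳ-≤-nonNeg σ {{nonNegative (<⇒≤ (σ-pos s s≥1))}} h1) (≤-reflexive (*-identityˡ σ)))))
      k< : k ℕ.< s ℕ.+ 1
      k< = subst (k ℕ.<_) (sym s+1≡) (ℕ.s≤s k≤s)
      m : Fin (s ℕ.+ 1)
      m = F.fromℕ< k<

  -- Conversely, if [(x,0),(y,s)] with x integral contains s + 1 lattice points, then
  -- y − x = s·W with W integral: the heights of the lattice points are distinct integers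
  -- in [0,s], so by pigeonhole one of them is 1, and that point is (x + W, 1).
  latticeCount⇒divisible : ∀ {n} (s : ℕ) → 1 ℕ.≤ s → {x y : Point n} (xz : LPoint n) → x ≋ toℚ xz →
    LatticeCount (lift x 0ℚ) (lift y (σℚ s)) (s ℕ.+ 1) → ∃ λ (W : LPoint n) → ∀ l → y l - x l ≡ σℚ s * ι (W l)
  latticeCount⇒divisible {n} s s≥1 {x} {y} xz xX (f , finj , fseg , fcomp) =
    fromHeight1 (distinct-hits-1 s s≥1 k k≤s kinj)
    where
    σ = σℚ s
    t : Fin (s ℕ.+ 1) → ℚ
    t i = proj₁ (fseg i)
    hl : Fin (s ℕ.+ 1) → ℤ
    hl i = f i (F.fromℕ n)
    coord : ∀ i l → ι (f i l) ≡ (1ℚ - t i) * lift x 0ℚ l + t i * lift y σ l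
    coord i l = proj₂ (proj₂ (proj₂ (fseg i))) l
    eh : ∀ i → ι (hl i) ≡ t i * σ
    eh i = trans (coord i (F.fromℕ n)) (trans (cong₂ (λ u v → (1ℚ - t i) * u + t i * v) (lift-lst x 0ℚ) (lift-lst y σ))
              (solve 2 (λ t σ → (con 1ℚ :- t) :* con 0ℚ :+ t :* σ := t :* σ) refl (t i) σ))
    hl≥0 : ∀ i → ℤ.+ 0 ℤ.≤ hl i
    hl≥0 i = ι-cancel (≤-trans (nn*nn (proj₁ (proj₂ (fseg i))) (<⇒≤ (σ-pos s s≥1))) (≤-reflexive (sym (eh i))))
    k : Fin (s ℕ.+ 1) → ℕ
    k i = proj₁ (nonneg-int (hl i) (hl≥0 i))
    hk : ∀ i → hl i ≡ ℤ.+ k i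
    hk i = proj₂ (nonneg-int (hl i) (hl≥0 i))
    tk : ∀ i → t i * σ ≡ ι (ℤ.+ k i)
    tk i = trans (sym (eh i)) (cong ι (hk i))
    k≤s : ∀ i → k i ℕ.≤ s
    k≤s i = ℤP.drop‿+≤+ (ι-cancel (≤-trans (≤-reflexive (sym (tk i))) (≤-trans (*-monoʳ-≤-nonNeg σ {{nonNegative (<⇒≤ (σ-pos s s≥1))}} (proj₁ (proj₂ (proj₂ (fseg i))))) (≤-reflexive (*-identityˡ σ)))))
    kinj : ∀ i j → k i ≡ k j → i ≡ j
    kinj i j e = finj i j (λ l → ι-inj (trans (coord i l) (trans (cong (λ u → (1ℚ - u) * lift x 0ℚ l + u * lift y σ l) ti≡tj) (sym (coord j l)))))
      where
      ti≡tj : t i ≡ t j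
      ti≡tj = -≡0⇒≡ (mul-cancel (σ≢0 s s≥1) (trans (solve 3 (λ a b σ → σ :* (a :- b) := a :* σ :- b :* σ) refl (t i) (t j) σ)
             (trans (cong₂ _-_ (tk i) (trans (tk j) (cong (λ z → ι (ℤ.+ z)) (sym e)))) (+-inverseʳ (ι (ℤ.+ k i))))))
    fromHeight1 : (∃ λ i → k i ≡ 1) → ∃ λ (W : LPoint n) → ∀ l → y l - x l ≡ σ * ι (W l)
    fromHeight1 (i , k1) = W , λ l → sym (begin
        σ * ι (W l) ≡⟨ cong (σ *_) (ι-- (f i (F.inject₁ l)) (xz l)) ⟩
        σ * (ι (f i (F.inject₁ l)) - ι (xz l)) ≡⟨ cong₂ (λ u v → σ * (u - v)) (trans (coord i (F.inject₁ l)) (cong₂ (λ u v → (1ℚ - t i) * u + t i * v) (lift-inj x 0ℚ l) (lift-inj y σ l))) (sym (xX l)) ⟩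
        σ * ((1ℚ - t i) * x l + t i * y l - x l) ≡⟨ solve 4 (λ σ t x y → σ :* ((con 1ℚ :- t) :* x :+ t :* y :- x) := (t :* σ) :* (y :- x)) refl σ (t i) (x l) (y l) ⟩
        (t i * σ) * (y l - x l) ≡⟨ cong (_* (y l - x l)) (trans (tk i) (cong (λ z → ι (ℤ.+ z)) k1)) ⟩
        1ℚ * (y l - x l) ≡⟨ *-identityˡ (y l - x l) ⟩
        y l - x l ∎)
      where
      open ≡-Reasoning
      W : LPoint n
      W l = f i (F.inject₁ l) ℤ.- xz l

  -- In a basis of ℤⁿ⁺¹ all of whose vectors but one have height 0, that vector has height ±1:
  -- otherwise the last unit vector would not be an integral combination of the basis.
  basis-lastUnit : ∀ {n} (w : Fin (suc n) → LPoint (suc n)) i₀ → IsBasis w →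
    (∀ j → j ≢ i₀ → w j (F.fromℕ n) ≡ ℤ.+ 0) → ℤ.∣ w i₀ (F.fromℕ n) ∣ ≡ 1
  basis-lastUnit {n} w i₀ w-basis flat = unit-abs (a i₀) (w i₀ (F.fromℕ n)) a-eq
    where
    elast : LPoint (suc n)
    elast = liftZ (λ _ → ℤ.+ 0) (ℤ.+ 1)
    a = proj₁ (proj₁ w-basis elast)
    a-eq : a i₀ ℤ.* w i₀ (F.fromℕ n) ≡ ℤ.+ 1
    a-eq = trans (sym (sumℤ-single (λ j → a j ℤ.* w j (F.fromℕ n)) i₀ (λ j j≢ → trans (cong (a j ℤ.*_) (flat j j≢)) (ℤP.*-zeroʳ (a j)))))
      (trans (proj₂ (proj₁ w-basis elast) (F.fromℕ n)) (liftZ-lst {n} (λ _ → ℤ.+ 0) (ℤ.+ 1)))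

  extendBasis : ∀ {n} → (Fin n → LPoint n) → LPoint n → ℤ → Fin (suc n) → LPoint (suc n)
  extendBasis wa W ε zero = liftZ W ε
  extendBasis wa W ε (suc i) = liftZ (wa i) (ℤ.+ 0)

  -- If ε = ±1, extending a basis of ℤⁿ this way gives a basis of ℤⁿ⁺¹: the last coordinate
  -- of a combination determines the coefficient of the new vector, the rest is solved in ℤⁿ.
  extendBasis-isBasis : ∀ {n} (wa : Fin n → LPoint n) (W : LPoint n) (ε : ℤ) → ℤ.∣ ε ∣ ≡ 1 →
    IsBasis wa → IsBasis (extendBasis wa W ε)
  extendBasis-isBasis {n} wa W ε absε wa-basis = span , indep
    where
    combI : ∀ (a : Fin (suc n) → ℤ) l → sumℤ (λ j → a j ℤ.* extendBasis wa W ε j (F.inject₁ l)) ≡ a zero ℤ.* W l ℤ.+ sumℤ (λ i → a (suc i) ℤ.* wa i l)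
    combI a l = cong₂ (λ p q → a zero ℤ.* p ℤ.+ q) (liftZ-inj W ε l) (sumℤ-cong (λ i → cong (λ q → a (suc i) ℤ.* q) (liftZ-inj (wa i) (ℤ.+ 0) l)))
    combL : ∀ (a : Fin (suc n) → ℤ) → sumℤ (λ j → a j ℤ.* extendBasis wa W ε j (F.fromℕ n)) ≡ a zero ℤ.* ε
    combL a = trans (cong₂ (λ p q → a zero ℤ.* p ℤ.+ q) (liftZ-lst W ε)
                      (trans (sumℤ-cong (λ i → cong (λ q → a (suc i) ℤ.* q) (liftZ-lst (wa i) (ℤ.+ 0)))) (sumℤ-*0 (λ i → a (suc i)))))
                (ℤP.+-identityʳ (a zero ℤ.* ε))

    span : ∀ (z : LPoint (suc n)) → ∃ λ (a : Fin (suc n) → ℤ) → ∀ i → sumℤ (λ j → a j ℤ.* extendBasis wa W ε j i) ≡ z i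
    span z = a , finExt (λ i → sumℤ (λ j → a j ℤ.* extendBasis wa W ε j i)) z
        (λ l → trans (combI a l) (trans (cong (λ q → a0 ℤ.* W l ℤ.+ q) (proj₂ (proj₁ wa-basis z') l))
               (ℤS.solve 3 (λ a w z → a ℤS.:* w ℤS.:+ (z ℤS.:- a ℤS.:* w) ℤS.:= z) refl a0 (W l) (z (F.inject₁ l)))))
        (trans (combL a) (trans (ℤP.*-assoc ε zl ε) (trans (cong (λ q → ε ℤ.* q) (ℤP.*-comm zl ε)) (trans (sym (ℤP.*-assoc ε ε zl))
           (trans (cong (λ q → q ℤ.* zl) (ε²≡1 ε absε)) (ℤP.*-identityˡ zl))))))
      where
      zl = z (F.fromℕ n)
      a0 = ε ℤ.* zl
      z' : LPoint n
      z' l = z (F.inject₁ l) ℤ.- a0 ℤ.* W l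
      b = proj₁ (proj₁ wa-basis z')
      a : Fin (suc n) → ℤ
      a zero = a0
      a (suc i) = b i

    indep : ∀ (a : Fin (suc n) → ℤ) → (∀ i → sumℤ (λ j → a j ℤ.* extendBasis wa W ε j i) ≡ ℤ.+ 0) → ∀ j → a j ≡ ℤ.+ 0
    indep a h = λ { zero → a0 ; (suc i) → proj₂ wa-basis (λ i → a (suc i)) rest i }
      where
      a0 : a zero ≡ ℤ.+ 0
      a0 = trans (sym (ℤP.*-identityʳ (a zero))) (trans (cong (λ q → a zero ℤ.* q) (sym (ε²≡1 ε absε)))
           (trans (sym (ℤP.*-assoc (a zero) ε ε)) (trans (cong (λ q → q ℤ.* ε) (trans (sym (combL a)) (h (F.fromℕ n)))) (ℤP.*-zeroˡ ε))))
      rest : ∀ l → sumℤ (λ i → a (suc i) ℤ.* wa i l) ≡ ℤ.+ 0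
      rest l = trans (sym (ℤP.+-identityˡ _)) (trans (cong (λ q → q ℤ.+ sumℤ (λ i → a (suc i) ℤ.* wa i l)) (sym (trans (cong (λ q → q ℤ.* W l) a0) (ℤP.*-zeroˡ (W l)))))
               (trans (sym (combI a l)) (h (F.inject₁ l))))

  SmoothAt : ∀ {n} → PSet n → Point n → Set
  SmoothAt {n} P v =
    Σ (Fin n → Point n) λ u → Σ (Fin n → LPoint n) λ w →
      (∀ i j → u i ≋ u j → i ≡ j) ×
      (∀ i → IsEdge P v (u i)) ×
      (∀ y → IsEdge P v y → ∃ λ i → u i ≋ y) ×
      (∀ i → IsPrimitiveDir (λ l → u i l - v l) (w i)) ×
      IsBasis w

  module SmoothAtData {n} {P : PSet n} {v : Point n} (sm : SmoothAt P v) where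
    ends : Fin n → Point n
    ends = proj₁ sm
    dirs : Fin n → LPoint n
    dirs = proj₁ (proj₂ sm)
    ends-distinct : ∀ i j → ends i ≋ ends j → i ≡ j
    ends-distinct = proj₁ (proj₂ (proj₂ sm))
    ends-edges : ∀ i → IsEdge P v (ends i)
    ends-edges = proj₁ (proj₂ (proj₂ (proj₂ sm)))
    edges-complete : ∀ y → IsEdge P v y → ∃ λ i → ends i ≋ y
    edges-complete = proj₁ (proj₂ (proj₂ (proj₂ (proj₂ sm))))
    dirs-primitive : ∀ i → IsPrimitiveDir (λ l → ends i l - v l) (dirs i)
    dirs-primitive = proj₁ (proj₂ (proj₂ (proj₂ (proj₂ (proj₂ sm)))))
    dirs-basis : IsBasis dirs
    dirs-basis = proj₂ (proj₂ (proj₂ (proj₂ (proj₂ (proj₂ sm)))))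

  module LocalSmoothness {n ka kb} (Va : Fin ka → LPoint n) (Vb : Fin kb → LPoint n) (ha hb : ℚ) (hne : ha ≢ hb)
    (σ : ℚ) (σ>0 : 0ℚ < σ) (ε : ℤ) (absε : ℤ.∣ ε ∣ ≡ 1) (hbha : hb - ha ≡ σ * ι ε) where
    open CayleyHull Va Vb ha hb hne
    open CayleyEdges Va Vb ha hb hne

    -- Smoothness of CC at v ≋ (x,ha), for a vertex x of Pa exposed by c' and the vertex y of
    -- Pb exposed by the same normal, with y − x = σ·W: the n + 1 edges at (x,ha) are the n
    -- lifted edges of Pa and the edge to (y,hb), with primitive directions the lifted basis
    -- of Pa together with (W, ε).
    module AtLiftedVertex (smA : ∀ v → IsVertex Pa v → SmoothAt Pa v) (fanAB : Fan Pa Pb) (jb : Fin kb)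
      {c' x y} (Hx : ∀ w → Face c' Pa w ⇔ (w ≋ x)) (Hy : ∀ w → Face c' Pb w ⇔ (w ≋ y))
      (W : LPoint n) (yW : ∀ l → y l - x l ≡ σ * ι (W l)) (v : Point (suc n)) (vX : v ≋ lift x ha) where

      X = lift x ha
      Y = lift y hb
      open SmoothAtData (smA x (c' , Hx)) renaming
        (ends to ua; dirs to wa; ends-distinct to uainj; ends-edges to uaedge;
         edges-complete to uacomp; dirs-primitive to uaprim; dirs-basis to uabasis)
      px : Pa x
      px = proj₁ (from (Hx x) ≋-refl)
      py : Pb y
      py = proj₁ (from (Hy y) ≋-refl)
      neB : ∀ c → ∃ λ u → Face c Pb u
      neB = face-nonempty Vb jb

      u' : Fin (suc n) → Point (suc n)
      u' zero = Y
      u' (suc i) = lift (ua i) ha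
      w' : Fin (suc n) → LPoint (suc n)
      w' = extendBasis wa W ε

      hdiff : ∀ {p q : Point n} → ¬ (lift p hb ≋ lift q ha)
      hdiff e = hne (sym (proj₂ (lift-≋-inv e)))

      uinj : ∀ i j → u' i ≋ u' j → i ≡ j
      uinj zero zero e = refl
      uinj zero (suc j) e = ⊥-elim (hdiff e)
      uinj (suc i) zero e = ⊥-elim (hdiff (≋-sym e))
      uinj (suc i) (suc j) e = cong suc (uainj i j (proj₁ (lift-≋-inv e)))

      toV : ∀ {c z} → (∀ y → Face c CC y ⇔ Seg X z y) → ∀ y → Face c CC y ⇔ Seg v z y
      toV = seg-pt⇔ (≋-sym vX) ≋-refl

      uedge : ∀ i → IsEdge CC v (u' i)
      uedge zero = (λ e → hdiff (≋-sym (≋-trans (≋-sym vX) e))) , c0 , toV {c = c0} (proj₂ (upEdge {c'} Hx Hy))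
        where
        c0 = proj₁ (upEdge {c'} Hx Hy)
      uedge (suc i) = (λ e → proj₁ (uaedge i) (proj₁ (lift-≋-inv (≋-trans (≋-sym vX) e)))) ,
        c1 , toV {c = c1} (proj₂ (liftedFace {c' = ci} (proj₂ (proj₂ (uaedge i)))))
        where
        ci = proj₁ (proj₂ (uaedge i))
        c1 = proj₁ (liftedFace {c' = ci} (proj₂ (proj₂ (uaedge i))))

      -- Every edge at X ends at a generator; a generator at height ha gives a lifted edge of Pa,
      -- one at height hb is (y,hb) by uniqueness of the corresponding vertex.
      ucomp' : ∀ z c → ¬ (X ≋ z) → (∀ y → Face c CC y ⇔ Seg X z y) → (∃ λ g → SG g × g ≋ z) → ∃ λ i → u' i ≋ z
      ucomp' z c ne H (g , inj₁ (z' , pz' , gz') , gz) = suc i , ≋-trans (lift-≋ (proj₂ (uacomp z' eA)) refl) zz'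
        where
        zz' : lift z' ha ≋ z
        zz' = ≋-trans (≋-sym gz') gz
        H'' = seg-pt⇔ ≋-refl (≋-sym zz') H
        eA : IsEdge Pa x z'
        eA = Bottom.edge-same {c = c} H'' px pz' (λ e → ne (≋-trans e zz'))
        i = proj₁ (uacomp z' eA)
      ucomp' z c ne H (g , inj₂ (z' , pz' , gz') , gz) = zero , ≋-trans (lift-≋ yz' refl) zz'
        where
        zz' : lift z' hb ≋ z
        zz' = ≋-trans (≋-sym gz') gz
        H'' : ∀ y → Face c CC y ⇔ Seg X (lift z' hb) y
        H'' = seg-pt⇔ ≋-refl (≋-sym zz') H
        yz' : y ≋ z'
        yz' = fan-unique {Pa = Pa} {Pb = Pb} fanAB neB {c = c'} {d = ini c} Hx (Bottom.edge-end-face {c = c} H'' hne px)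
                Hy (Top.edge-end-face {c = c} (seg-sym⇔ H'') (λ e → hne (sym e)) pz')

      ucomp : ∀ z → IsEdge CC v z → ∃ λ i → u' i ≋ z
      ucomp z (ne , c , H) = ucomp' z c (λ e → ne (≋-trans vX e)) H' (edge-end {S = SG} c X z (λ e → ne (≋-trans vX e)) H')
        where
        H' : ∀ y → Face c CC y ⇔ Seg X z y
        H' = seg-pt⇔ vX ≋-refl H

      -- The directions are primitive: (W, ε) because ε = ±1, the lifted ones because the
      -- directions of Pa are.
      uprim : ∀ i → IsPrimitiveDir (λ l → u' i l - v l) (w' i)
      uprim zero = (λ m d → div-unit m ε absε (subst (ℤD._∣_ (ℤ.+ m)) (liftZ-lst W ε) (d (F.fromℕ n)))) , σ , σ>0 ,
        finExt (λ l → Y l - v l) (λ l → σ * ι (liftZ W ε l))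
          (λ l → trans (cong₂ _-_ (lift-inj y hb l) (trans (vX (F.inject₁ l)) (lift-inj x ha l)))
                   (trans (yW l) (cong (λ z → σ * ι z) (sym (liftZ-inj W ε l)))))
          (trans (cong₂ _-_ (lift-lst y hb) (trans (vX (F.fromℕ n)) (lift-lst x ha)))
                   (trans hbha (cong (λ z → σ * ι z) (sym (liftZ-lst W ε)))))
      uprim (suc i) = (λ m d → proj₁ (uaprim i) m (λ l → subst (ℤD._∣_ (ℤ.+ m)) (liftZ-inj (wa i) (ℤ.+ 0) l) (d (F.inject₁ l)))) ,
        r , r>0 ,
        finExt (λ l → lift (ua i) ha l - v l) (λ l → r * ι (liftZ (wa i) (ℤ.+ 0) l))
          (λ l → trans (cong₂ _-_ (lift-inj (ua i) ha l) (trans (vX (F.inject₁ l)) (lift-inj x ha l)))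
                   (trans (proj₂ (proj₂ (proj₂ (uaprim i))) l) (cong (λ z → r * ι z) (sym (liftZ-inj (wa i) (ℤ.+ 0) l)))))
          (trans (cong₂ _-_ (lift-lst (ua i) ha) (trans (vX (F.fromℕ n)) (lift-lst x ha)))
                   (trans (+-inverseʳ ha) (trans (sym (*-zeroʳ r)) (cong (λ z → r * ι z) (sym (liftZ-lst (wa i) (ℤ.+ 0)))))))
        where
        r = proj₁ (proj₂ (uaprim i))
        r>0 = proj₁ (proj₂ (proj₂ (uaprim i)))

      smoothAt : SmoothAt CC v
      smoothAt = u' , w' , uinj , uedge , ucomp , uprim , extendBasis-isBasis wa W ε absε uabasis

  face⇔ : ∀ {m} {P Q : PSet m} {c x} → (∀ y → P y ⇔ Q y) → Face c P x → Face c Q x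
  face⇔ eq (px , mn) = to (eq _) px , λ y qy → mn y (from (eq y) qy)

  edge⇔ : ∀ {m} {P Q : PSet m} {v u} → (∀ y → P y ⇔ Q y) → IsEdge P v u → IsEdge Q v u
  edge⇔ {P = P} {Q} eq (ne , c , H) = ne , c , λ y → mk⇔ (λ fq → to (H y) (face⇔ {P = Q} {P} {c = c} eq' fq)) (λ sg → face⇔ {P = P} {Q} {c = c} eq (from (H y) sg))
    where
    eq' : ∀ y → Q y ⇔ P y
    eq' y = mk⇔ (from (eq y)) (to (eq y))

  smoothAt⇔ : ∀ {m} {P Q : PSet m} {v} → (∀ y → P y ⇔ Q y) → SmoothAt P v → SmoothAt Q v
  smoothAt⇔ {P = P} {Q} eq (u , w , ui , ue , uc , up , ub) =
    u , w , ui , (λ i → edge⇔ {P = P} {Q} eq (ue i)) , (λ y e → uc y (edge⇔ {P = Q} {P} eq' e)) , up , ub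
    where
    eq' : ∀ y → Q y ⇔ P y
    eq' y = mk⇔ (from (eq y)) (to (eq y))

  module CayleySmoothness {n k₀ k₁} (V₀ : Fin k₀ → LPoint n) (V₁ : Fin k₁ → LPoint n) (s : ℕ) (s≥1 : 1 ℕ.≤ s) where
    σ = σℚ s
    hne : 0ℚ ≢ σ
    hne = 0≢σ s s≥1
    open CayleyHull V₀ V₁ 0ℚ σ hne
    open CayleyEdges V₀ V₁ 0ℚ σ hne

    liftVertex : ∀ {x} → IsVertex Pa x → IsVertex CC (lift x 0ℚ)
    liftVertex {x} (cx , Hx) = proj₁ (liftedFace {c' = cx} {x} {x} (vert⇔seg Hx)) , seg⇔vert (proj₂ (liftedFace {c' = cx} {x} {x} (vert⇔seg Hx)))

    module AtVerticalEdge (fan : Fan Pa Pb) (smooth : ∀ v → IsVertex CC v → SmoothAt CC v)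
      {x y : Point n} {cx cy} (Hx : ∀ w → Face cx Pa w ⇔ (w ≋ x)) (Hy : ∀ w → Face cy Pb w ⇔ (w ≋ y))
      (E : IsEdge CC (lift x 0ℚ) (lift y σ)) where

      cE = proj₁ (proj₂ E)
      HE = proj₂ (proj₂ E)
      X = lift x 0ℚ
      Y = lift y σ
      open SmoothAtData (smooth X (liftVertex (cx , Hx))) renaming
        (ends to u; dirs to w; ends-distinct to uinj; ends-edges to uedge;
         edges-complete to ucomp; dirs-primitive to uprim; dirs-basis to ubasis)
      i0 = proj₁ (ucomp Y E)
      ui0≋Y : u i0 ≋ Y
      ui0≋Y = proj₂ (ucomp Y E)
      px : Pa x
      px = proj₁ (from (Hx x) ≋-refl)
      py : Pb y
      py = proj₁ (from (Hy y) ≋-refl)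
      HEa : ∀ w → Face (ini cE) Pa w ⇔ (w ≋ x)
      HEa = Bottom.edge-end-face {c = cE} HE hne px
      HEb : ∀ w → Face (ini cE) Pb w ⇔ (w ≋ y)
      HEb = Top.edge-end-face {c = cE} (seg-sym⇔ HE) (λ e → hne (sym e)) py
      neB : ∀ c → ∃ λ u → Face c Pb u
      neB = face-nonempty V₁ (lp-inhabited V₁ py)
      -- Every other edge at X ends at height 0: an end at height s would be the vertex of
      -- P₁ corresponding to x, i.e. y, contradicting distinctness of the edges.
      lastZero' : ∀ j → j ≢ i0 → ∃ (λ g → SG g × g ≋ u j) → lst (u j) ≡ 0ℚ
      lastZero' j j≢ (g , inj₁ (z , pz , gz) , gu) = trans (≋-trans (≋-sym gu) gz (F.fromℕ n)) (lift-lst z 0ℚ)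
      lastZero' j j≢ (g , inj₂ (z , pz , gz) , gu) = ⊥-elim (j≢ (uinj j i0 (≋-trans uz (≋-trans (lift-≋ (≋-sym yz) refl) (≋-sym ui0≋Y)))))
        where
        uz : u j ≋ lift z σ
        uz = ≋-trans (≋-sym gu) gz
        cj = proj₁ (proj₂ (uedge j))
        Hj' : ∀ y → Face cj CC y ⇔ Seg X (lift z σ) y
        Hj' = seg-pt⇔ ≋-refl uz (proj₂ (proj₂ (uedge j)))
        yz : y ≋ z
        yz = fan-unique {Pa = Pa} {Pb = Pb} fan neB {c = ini cE} {d = ini cj} HEa (Bottom.edge-end-face {c = cj} Hj' hne px) HEb (Top.edge-end-face {c = cj} (seg-sym⇔ Hj') (λ e → hne (sym e)) pz)
      lastZero : ∀ j → j ≢ i0 → lst (u j) ≡ 0ℚ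
      lastZero j j≢ = lastZero' j j≢ (edge-end {S = SG} (proj₁ (proj₂ (uedge j))) X (u j) (proj₁ (uedge j)) (proj₂ (proj₂ (uedge j))))
      dirLast : ∀ j → u j (F.fromℕ n) - X (F.fromℕ n) ≡ proj₁ (proj₂ (uprim j)) * ι (w j (F.fromℕ n))
      dirLast j = proj₂ (proj₂ (proj₂ (uprim j))) (F.fromℕ n)
      r-pos : ∀ j → 0ℚ < proj₁ (proj₂ (uprim j))
      r-pos j = proj₁ (proj₂ (proj₂ (uprim j)))
      -- So all primitive directions but the i0-th have height 0 …
      wZero : ∀ j → j ≢ i0 → w j (F.fromℕ n) ≡ ℤ.+ 0
      wZero j j≢ = ι-inj (mul-cancel (λ e → <-irrefl (sym e) (r-pos j))
        (trans (sym (dirLast j)) (trans (cong₂ _-_ (lastZero j j≢) (lift-lst x 0ℚ)) refl)))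
      r = proj₁ (proj₂ (uprim i0))
      σeq : σ ≡ r * ι (w i0 (F.fromℕ n))
      σeq = trans (sym (trans (cong₂ _-_ (trans (ui0≋Y (F.fromℕ n)) (lift-lst y σ)) (lift-lst x 0ℚ)) (+-identityʳ σ))) (dirLast i0)
      -- … and the i0-th has height ±1 (basis-lastUnit), in fact 1 since s > 0.
      wl1 : w i0 (F.fromℕ n) ≡ ℤ.+ 1
      wl1 = pos-unit σ r (w i0 (F.fromℕ n)) (σ-pos s s≥1) (r-pos i0) σeq (abs1 (w i0 (F.fromℕ n)) (basis-lastUnit w i0 ubasis wZero))
      r≡σ : r ≡ σ
      r≡σ = sym (trans σeq (trans (cong (λ z → r * ι z) wl1) (*-identityʳ r)))
      W : LPoint n
      W l = w i0 (F.inject₁ l)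
      yeq : ∀ l → y l ≡ x l + σ * ι (W l)
      yeq l = trans (solve 2 (λ y x → y := x :+ (y :- x)) refl (y l) (x l))
        (cong (x l +_) (trans (cong₂ _-_ (trans (sym (lift-inj y σ l)) (sym (ui0≋Y (F.inject₁ l)))) (sym (lift-inj x 0ℚ l)))
          (trans (proj₂ (proj₂ (proj₂ (uprim i0))) (F.inject₁ l)) (cong (_* ι (W l)) r≡σ))))
      jx = proj₁ (lattice-vertex V₀ {c = cx} Hx)
      xlat : x ≋ toℚ (V₀ jx)
      xlat = proj₂ (lattice-vertex V₀ {c = cx} Hx)

      latticeCount : LatticeCount (lift x 0ℚ) (lift y σ) (s ℕ.+ 1)
      latticeCount = divisible⇒latticeCount s s≥1 (V₀ jx) W xlat yeq

    -- Forward direction: if P is smooth at (x,0), the edges at (x,0) other than the edge to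
    -- (y,s) stay at height 0, so in the basis of primitive edge directions only the direction
    -- of that edge has nonzero height, which must then be 1: (y,s) − (x,0) = s·(W,1).
    forward : Fan Pa Pb → (∀ v → IsVertex CC v → SmoothAt CC v) →
      ∀ x y → IsVertex Pa x → IsVertex Pb y → IsEdge CC (lift x 0ℚ) (lift y σ) →
      LatticeCount (lift x 0ℚ) (lift y σ) (s ℕ.+ 1)
    forward fan smooth x y (cx , Hx) (cy , Hy) E = AtVerticalEdge.latticeCount fan smooth {cx = cx} {cy} Hx Hy E

    hne' : σ ≢ 0ℚ
    hne' e = hne (sym e)

    neXY : ∀ {x y : Point n} → ¬ (lift x 0ℚ ≋ lift y σ)
    neXY e = hne (proj₂ (lift-≋-inv e))

    EdgeCount : Set
    EdgeCount = ∀ x y → IsVertex Pa x → IsVertex Pb y → IsEdge CC (lift x 0ℚ) (lift y σ) →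
      LatticeCount (lift x 0ℚ) (lift y σ) (s ℕ.+ 1)

    verticalDirection : EdgeCount → ∀ {c' x y} → (∀ w → Face c' Pa w ⇔ (w ≋ x)) →
      (∀ w → Face c' Pb w ⇔ (w ≋ y)) → ∃ λ (W : LPoint n) → ∀ l → y l - x l ≡ σ * ι (W l)
    verticalDirection count {c'} {x} {y} Hx Hy =
      latticeCount⇒divisible s s≥1 (V₀ (proj₁ xV)) (proj₂ xV) (count x y (c' , Hx) (c' , Hy) (neXY , upEdge {c'} Hx Hy))
      where
      xV = lattice-vertex V₀ {c = c'} Hx

    smoothAtBottom : Smooth Pa → SameNormalFan Pa Pb → Fin k₁ → EdgeCount →
      ∀ {c v x} → (∀ z → Face c CC z ⇔ (z ≋ v)) → Pa x → v ≋ lift x 0ℚ → SmoothAt CC v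
    smoothAtBottom sm0 fan j1 count {c} {v} {x} Hv px vX =
      LocalSmoothness.AtLiftedVertex.smoothAt V₀ V₁ 0ℚ σ hne σ (σ-pos s s≥1) (ℤ.+ 1) refl hbha sm0 (proj₁ fan) j1
        {c'} Hx Hy (proj₁ W) (proj₂ W) v vX
      where
      vx : IsVertex Pa x
      vx = Bottom.vert-side {c = c} Hv px vX
      c' = proj₁ vx
      Hx = proj₂ vx
      Hy = proj₂ (corrVertex (proj₂ fan) j1 {c'} Hx)
      W = verticalDirection count {c'} Hx Hy
      hbha : σ - 0ℚ ≡ σ * ι (ℤ.+ 1)
      hbha = solve 1 (λ σ → σ :- con 0ℚ := σ :* con 1ℚ) refl σ

    -- P is also the Cayley polytope of (P₁, P₀) with the heights exchanged.
    module Swapped = CayleyHull V₁ V₀ σ 0ℚ hne'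
    module SwappedEdges = CayleyEdges V₁ V₀ σ 0ℚ hne'

    swapEq : ∀ y → Swapped.CC y ⇔ CC y
    swapEq y = mk⇔ (conv-mono {S = Swapped.SG} {T = SG} [ inj₂ , inj₁ ]′) (conv-mono {S = SG} {T = Swapped.SG} [ inj₂ , inj₁ ]′)

    -- Smoothness at a vertex (y,s) of the top facet: the bottom case for the swapped
    -- Cayley polytope, where the vertical direction is s·(−W, −1).
    smoothAtTop : Smooth Pb → SameNormalFan Pa Pb → Fin k₀ → EdgeCount →
      ∀ {c v y} → (∀ z → Face c CC z ⇔ (z ≋ v)) → Pb y → v ≋ lift y σ → SmoothAt CC v
    smoothAtTop sm1 fan j0 count {c} {v} {y} Hv py vY =
      smoothAt⇔ {P = Swapped.CC} {CC} swapEq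
        (LocalSmoothness.AtLiftedVertex.smoothAt V₁ V₀ σ 0ℚ hne' σ (σ-pos s s≥1) (ℤ.-[1+ 0 ]) refl hbha sm1 (proj₂ fan) j0
          {c'} Hy Hx W' xW v vY)
      where
      vy : IsVertex Pb y
      vy = Top.vert-side {c = c} Hv py vY
      c' = proj₁ vy
      Hy = proj₂ vy
      cv = SwappedEdges.corrVertex (proj₁ fan) j0 {c'} Hy
      x = proj₁ cv
      Hx = proj₂ cv
      W = verticalDirection count {c'} Hx Hy
      W' : LPoint n
      W' l = ℤ.- proj₁ W l
      xW : ∀ l → x l - y l ≡ σ * ι (W' l)
      xW l = trans (solve 2 (λ x y → x :- y := :- (y :- x)) refl (x l) (y l))
        (trans (cong -_ (proj₂ W l)) (trans (solve 2 (λ σ w → :- (σ :* w) := σ :* (:- w)) refl σ (ι (proj₁ W l)))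
          (cong (σ *_) (sym (ι-neg (proj₁ W l))))))
      hbha : 0ℚ - σ ≡ σ * ι (ℤ.-[1+ 0 ])
      hbha = solve 1 (λ σ → con 0ℚ :- σ := σ :* con (ι ℤ.-[1+ 0 ])) refl σ

    -- Backward direction: every vertex of P is the lift of a point of P₀ or of P₁.
    backward : Smooth Pa → Smooth Pb → SameNormalFan Pa Pb → Fin k₀ → Fin k₁ → EdgeCount → Smooth CC
    backward sm0 sm1 fan j0 j1 count v (c , Hv) = atGenerator (vert-gen {S = SG} c v Hv)
      where
      atGenerator : (∃ λ g → SG g × g ≋ v) → SmoothAt CC v
      atGenerator (g , inj₁ (x , px , gx) , gv) = smoothAtBottom sm0 fan j1 count {c} Hv px (≋-trans (≋-sym gv) gx)
      atGenerator (g , inj₂ (y , py , gy) , gv) = smoothAtTop sm1 fan j0 count {c} Hv py (≋-trans (≋-sym gv) gy)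

open SmoothCayley using (module CayleySmoothness; lp-inhabited)
open import Data.Nat using (ℕ; suc; _≤_; _+_)
open import Data.Fin using (Fin)
open import Data.Integer using (+_)
open import Data.Rational using (0ℚ; _/_)
open import Data.Product using (proj₁; proj₂)
open import Function.Bundles using (_⇔_; mk⇔)

-- The theorem: the forward direction at every vertex pair, the backward direction from
-- the local criterion at every vertex.
lemma1 : (n k₀ k₁ : ℕ) (V₀ : Fin k₀ → LPoint n) (V₁ : Fin k₁ → LPoint n) (s : ℕ) →
    1 ≤ s →
    FullDim (LatticePolytope V₀) → FullDim (LatticePolytope V₁) →
    Smooth (LatticePolytope V₀) → Smooth (LatticePolytope V₁) →
    SameNormalFan (LatticePolytope V₀) (LatticePolytope V₁) →
    FullDim (Cayley (LatticePolytope V₀) (LatticePolytope V₁) s) →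
    Smooth (Cayley (LatticePolytope V₀) (LatticePolytope V₁) s)
    ⇔ (∀ x y → IsVertex (LatticePolytope V₀) x → IsVertex (LatticePolytope V₁) y →
    IsEdge (Cayley (LatticePolytope V₀) (LatticePolytope V₁) s) (lift x 0ℚ) (lift y ((+ s) / 1)) →
    LatticeCount (lift x 0ℚ) (lift y ((+ s) / 1)) (s + 1))
lemma1 n k₀ k₁ V₀ V₁ s s≥1 fd₀ fd₁ sm₀ sm₁ fan _ =
  mk⇔ (forward (proj₁ fan)) (backward sm₀ sm₁ fan j₀ j₁)
  where
  open CayleySmoothness V₀ V₁ s s≥1
  j₀ = lp-inhabited V₀ (proj₂ (proj₁ fd₀))
  j₁ = lp-inhabited V₁ (proj₂ (proj₁ fd₁))
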